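{- Let $\Gamma$ be a connected simple graph on $n\geq 3$ vertices. Then $$ \sigma_{t}(\Gamma)\leq \begin{cases} \lceil \frac{n}{4}\rceil \cdot \lfloor \frac{3n}{4}\rfloor \left(n-1-\lceil \frac{n}{4}\rceil \right)^{2}, & \text{if } n \equiv 0 \pmod 4 \text{ or } n \equiv 3 \pmod 4;\\[2pt] \lfloor \frac{n}{4}\rfloor \cdot \lceil \frac{3n}{4}\rceil \left(n-1-\lfloor \frac{n}{4}\rfloor \right)^{2}, & \text{if } n \equiv 1 \pmod 4 \text{ or } n \equiv 2 \pmod 4.\end{cases} $$ If $n \equiv 0 \pmod 4$ or $n \equiv 3 \pmod 4$, equality holds for the split graph $S_{\lceil n/4\rceil, \lfloor 3n/4\rfloor}$, while if $n \equiv 1 \pmod 4$ or $n \equiv 2 \pmod 4$, equality holds for the split graph $S_{\lfloor n/4\rfloor, \lceil 3n/4\rceil}$.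
   Context: All graphs are finite, simple and undirected; $d(v)$ denotes the degree of vertex $v$. The $\sigma_t$-irregularity (sigma total index) of a graph $G$ is $\sigma_{t}(G)=\sum_{\{u,v\}\subseteq V(G)}(d(u)-d(v))^{2}$, the sum over all unordered pairs of distinct vertices. The split graph $S_{a,b}$ is the graph whose vertex set is partitioned into a clique of size $a$ and an independent set of size $b$, where every vertex of the independent set is adjacent to all vertices of the clique. -}

module Defs where

open import Data.Nat using (ℕ; zero; suc; _+_; _*_; _∸_; _^_; _≤_; _<_; _/_; _%_; ∣_-_∣; _<ᵇ_)
open import Data.Bool using (Bool; true; false; _∧_; _∨_; not; if_then_else_)
open import Data.Fin using (Fin; toℕ)
open import Data.Fin.Properties using (_≟_)
open import Data.Nat.ListAction using (sum)
open import Data.List using (List; []; _∷_; map; filter; length; allFin; concatMap)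
open import Data.List.Relation.Unary.Linked using (Linked)
open import Data.List using (head; last)
open import Data.Maybe using (just)
open import Data.Product using (_×_; Σ; ∃; _,_)
open import Relation.Binary.PropositionalEquality using (_≡_)
open import Relation.Nullary using (¬_)
open import Relation.Nullary.Decidable using (⌊_⌋)

record Graph (n : ℕ) : Set where
  field
    adj   : Fin n → Fin n → Bool
    sym   : ∀ u v → adj u v ≡ adj v u
    irrefl : ∀ v → adj v v ≡ false
open Graph public

degree : ∀ {n} → Graph n → Fin n → ℕ
degree G v = length (filter (λ u → adj G v u ≡? true) (allFin _))
  where
  open import Data.Bool.Properties renaming (_≟_ to _≡?_)

Walk : ∀ {n} → Graph n → Fin n → Fin n → Set
Walk G u v = Σ (List _) λ w →
  (head w ≡ just u) × (last w ≡ just v) × Linked (λ x y → adj G x y ≡ true) w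

Connected : ∀ {n} → Graph n → Set
Connected G = ∀ u v → Walk G u v

-- σ_t(G) = Σ over unordered pairs {u,v}, u ≠ v, of (d(u) − d(v))².
-- Pairs are enumerated as (u,v) with toℕ u < toℕ v; (d u − d v)² = |d u − d v|².
sigmaT : ∀ {n} → Graph n → ℕ
sigmaT {n} G =
  sum (concatMap (λ u → map (λ v → if toℕ u <ᵇ toℕ v
                                      then ∣ degree G u - degree G v ∣ ^ 2
                                      else 0)
                             (allFin n))
                 (allFin n))

-- Split graph S_{a,b} on Fin (a + b): vertices with index < a form the clique,
-- the remaining b vertices an independent set, each joined to every clique vertex.
-- u ~ v iff u ≠ v and (u in clique or v in clique).
splitAdj : (a b : ℕ) → Fin (a + b) → Fin (a + b) → Bool
splitAdj a b u v = not ⌊ u ≟ v ⌋ ∧ ((toℕ u <ᵇ a) ∨ (toℕ v <ᵇ a))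

open import Data.Bool.Properties using (∧-comm; ∨-comm)
open import Relation.Binary.PropositionalEquality using (cong₂; cong; refl)

private
  dec-sym : ∀ {n} (u v : Fin n) → ⌊ u ≟ v ⌋ ≡ ⌊ v ≟ u ⌋
  dec-sym u v with u ≟ v | v ≟ u
  ... | Relation.Nullary.yes _ | Relation.Nullary.yes _ = refl
  ... | Relation.Nullary.no _  | Relation.Nullary.no _  = refl
  ... | Relation.Nullary.yes p | Relation.Nullary.no q  = Data.Empty.⊥-elim (q (Relation.Binary.PropositionalEquality.sym p))
    where import Data.Empty
  ... | Relation.Nullary.no q  | Relation.Nullary.yes p = Data.Empty.⊥-elim (q (Relation.Binary.PropositionalEquality.sym p))
    where import Data.Empty

splitGraph : (a b : ℕ) → Graph (a + b)
splitGraph a b = record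
  { adj = splitAdj a b
  ; sym = λ u v → cong₂ _∧_ (cong not (dec-sym u v)) (∨-comm (toℕ u <ᵇ a) (toℕ v <ᵇ a))
  ; irrefl = λ v → irr v
  }
  where
  irr : ∀ v → splitAdj a b v v ≡ false
  irr v with v ≟ v
  ... | Relation.Nullary.yes _ = refl
  ... | Relation.Nullary.no ¬p = Data.Empty.⊥-elim (¬p refl)
    where import Data.Empty

ceil4 floor4 ceil34 floor34 : ℕ → ℕ
ceil4 n = (n + 3) / 4
floor4 n = n / 4
ceil34 n = (3 * n + 3) / 4
floor34 n = (3 * n) / 4

Case03 : ℕ → Set
Case03 n = (n % 4 ≡ 0) Data.Sum.⊎ (n % 4 ≡ 3)
  where import Data.Sum

Case12 : ℕ → Set
Case12 n = (n % 4 ≡ 1) Data.Sum.⊎ (n % 4 ≡ 2)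
  where import Data.Sum

{-# OPTIONS --safe #-}
module Submission where

-- For the degree sequence d of a graph on n vertices, σ_t = n ∑ d² − (∑ d)² is a positive
-- semidefinite quadratic form; with polar form cov, σ(d) ≤ cov(w, d) forces σ(d) ≤ σ(w). For the
-- centred degrees x = n d − ∑ d, cov(w, d) is the sum of x u + x v over the edges of a graph with
-- degrees w, and the threshold graph {uv : x u + x v > 0} maximises it; so it suffices to bound
-- threshold graphs. In one, the positive vertices form a clique, the others an independent set, and
-- the edges between them a Ferrers diagram; σ depends on the clique size, the number of cells and the
-- sum of squared row and column lengths, and grows with the latter. That sum is largest when the
-- cells fill whole rows, and σ is linear in a partially filled row up to a term of the sign of n − 4,
-- so σ is bounded by graphs with three degree classes, which in turn are dominated by split graphs.
-- Finally σ_t(S_{a,n−a}) = a (n − a)(n − a − 1)² increases in a until n − 2 ≤ 4a ≤ n + 1, then decreases.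

open import Algebra.Bundles using (CommutativeSemiring)

module FiniteSums {c ℓ} (R : CommutativeSemiring c ℓ) where

  open import Data.List using (List; []; _∷_; map; filter)
  open import Data.List.Relation.Unary.All using (All; []; _∷_)
  open import Data.List.Relation.Binary.Permutation.Propositional as ↭ using (_↭_; prep; swap)
  open import Relation.Nullary using (yes; no)
  open import Relation.Unary using (Pred; Decidable)
  open import Relation.Unary.Properties using (∁?)

  open CommutativeSemiring R
  open import Algebra.Properties.CommutativeSemigroup +-commutativeSemigroup using (x∙yz≈y∙xz)
  open import Relation.Binary.Reasoning.Setoid setoid

  infixr 10 ∑

  ∑ : ∀ {a} {A : Set a} → List A → (A → Carrier) → Carrier
  ∑ []       f = 0#
  ∑ (x ∷ xs) f = f x + ∑ xs f

  syntax ∑ xs (λ x → e) = ∑[ x ∈ xs ] e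

  module _ {a} {A : Set a} where

    ∑-congᴬ : ∀ {xs} {f g : A → Carrier} → All (λ x → f x ≈ g x) xs → ∑ xs f ≈ ∑ xs g
    ∑-congᴬ []            = refl
    ∑-congᴬ (fx≈gx ∷ eqs) = +-cong fx≈gx (∑-congᴬ eqs)

    ∑-cong : ∀ xs {f g : A → Carrier} → (∀ x → f x ≈ g x) → ∑ xs f ≈ ∑ xs g
    ∑-cong []       eq = refl
    ∑-cong (x ∷ xs) eq = +-cong (eq x) (∑-cong xs eq)

    ∑-zero : ∀ (xs : List A) → ∑[ x ∈ xs ] 0# ≈ 0#
    ∑-zero []       = refl
    ∑-zero (x ∷ xs) = trans (+-identityˡ _) (∑-zero xs)

    ∑-distrib-+ : ∀ xs (f g : A → Carrier) → ∑[ x ∈ xs ] (f x + g x) ≈ ∑ xs f + ∑ xs g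
    ∑-distrib-+ []       f g = sym (+-identityˡ 0#)
    ∑-distrib-+ (x ∷ xs) f g = begin
      (f x + g x) + ∑[ y ∈ xs ] (f y + g y)  ≈⟨ +-congˡ (∑-distrib-+ xs f g) ⟩
      (f x + g x) + (∑ xs f + ∑ xs g)        ≈⟨ +-assoc (f x) (g x) _ ⟩
      f x + (g x + (∑ xs f + ∑ xs g))        ≈⟨ +-congˡ (x∙yz≈y∙xz (g x) (∑ xs f) (∑ xs g)) ⟩
      f x + (∑ xs f + (g x + ∑ xs g))        ≈⟨ +-assoc (f x) (∑ xs f) _ ⟨
      (f x + ∑ xs f) + (g x + ∑ xs g)        ∎

    *-distribˡ-∑ : ∀ k xs (f : A → Carrier) → k * ∑ xs f ≈ ∑[ x ∈ xs ] (k * f x)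
    *-distribˡ-∑ k []       f = zeroʳ k
    *-distribˡ-∑ k (x ∷ xs) f = trans (distribˡ k (f x) (∑ xs f)) (+-congˡ (*-distribˡ-∑ k xs f))

    *-distribʳ-∑ : ∀ k xs (f : A → Carrier) → ∑ xs f * k ≈ ∑[ x ∈ xs ] (f x * k)
    *-distribʳ-∑ k []       f = zeroˡ k
    *-distribʳ-∑ k (x ∷ xs) f = trans (distribʳ k (f x) (∑ xs f)) (+-congˡ (*-distribʳ-∑ k xs f))

    ∑-filter : ∀ {p} {P : Pred A p} (P? : Decidable P) xs (f : A → Carrier) →
               ∑ xs f ≈ ∑ (filter P? xs) f + ∑ (filter (∁? P?) xs) f
    ∑-filter P? []       f = sym (+-identityˡ 0#)
    ∑-filter P? (x ∷ xs) f with P? x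
    ... | yes _ = trans (+-congˡ (∑-filter P? xs f)) (sym (+-assoc (f x) _ _))
    ... | no  _ = trans (+-congˡ (∑-filter P? xs f)) (x∙yz≈y∙xz (f x) _ _)

    ∑-↭ : ∀ {xs ys : List A} → xs ↭ ys → (f : A → Carrier) → ∑ xs f ≈ ∑ ys f
    ∑-↭ ↭.refl           f = refl
    ∑-↭ (prep x xs↭ys)   f = +-congˡ (∑-↭ xs↭ys f)
    ∑-↭ (swap x y xs↭ys) f = trans (x∙yz≈y∙xz (f x) (f y) _) (+-congˡ (+-congˡ (∑-↭ xs↭ys f)))
    ∑-↭ (↭.trans p q)    f = trans (∑-↭ p f) (∑-↭ q f)

  module _ {a b} {A : Set a} {B : Set b} where

    ∑-map : ∀ (g : A → B) xs (f : B → Carrier) → ∑ (map g xs) f ≈ ∑[ x ∈ xs ] f (g x)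
    ∑-map g []       f = refl
    ∑-map g (x ∷ xs) f = +-congˡ (∑-map g xs f)

    ∑-comm : ∀ xs ys (f : A → B → Carrier) → ∑[ x ∈ xs ] ∑[ y ∈ ys ] f x y ≈ ∑[ y ∈ ys ] ∑[ x ∈ xs ] f x y
    ∑-comm []       ys f = sym (∑-zero ys)
    ∑-comm (x ∷ xs) ys f = begin
      ∑ ys (f x) + ∑[ x′ ∈ xs ] ∑ ys (f x′)          ≈⟨ +-congˡ (∑-comm xs ys f) ⟩
      ∑ ys (f x) + ∑[ y ∈ ys ] ∑[ x′ ∈ xs ] f x′ y   ≈⟨ ∑-distrib-+ ys (f x) _ ⟨
      ∑[ y ∈ ys ] (f x y + ∑[ x′ ∈ xs ] f x′ y)      ∎

    ∑*∑ : ∀ xs ys (f : A → Carrier) (g : B → Carrier) → ∑ xs f * ∑ ys g ≈ ∑[ x ∈ xs ] ∑[ y ∈ ys ] (f x * g y)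
    ∑*∑ xs ys f g = trans (*-distribʳ-∑ (∑ ys g) xs f) (∑-cong xs (λ x → *-distribˡ-∑ (f x) ys g))

module Variance where

  open import Data.Nat as ℕ using (z≤n)
  open import Data.Integer using (ℤ; +_; -[1+_]; 0ℤ; 1ℤ; _+_; _*_; _-_; _≤_; +≤+)
  open import Data.Integer.Properties
    using (+-*-commutativeSemiring; pos-*; *-cancelˡ-≤-pos; +-mono-≤; ≤-refl; i≤j⇒0≤j-i; 0≤i-j⇒j≤i; *-monoˡ-≤-nonNeg)
  open import Data.Integer.Tactic.RingSolver using (solve-∀)
  open import Data.List using (List; []; _∷_; length; map)
  open import Data.List.Properties using (length-map)
  open import Relation.Binary.PropositionalEquality using (_≡_; refl; sym; trans; cong; cong₂; subst; module ≡-Reasoning)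

  open FiniteSums +-*-commutativeSemiring public

  0≤+ : ∀ n → 0ℤ ≤ + n
  0≤+ n = +≤+ z≤n

  square-nonneg : ∀ i → 0ℤ ≤ i * i
  square-nonneg (+ n)    = subst (0ℤ ≤_) (pos-* n n) (0≤+ (n ℕ.* n))
  square-nonneg -[1+ n ] = 0≤+ _

  0≤* : ∀ {a b} → 0ℤ ≤ a → 0ℤ ≤ b → 0ℤ ≤ a * b
  0≤* {+ m} {+ n} _ _ = subst (0ℤ ≤_) (pos-* m n) (0≤+ (m ℕ.* n))

  ≤-of-nonneg-+ : ∀ {a b} d → 0ℤ ≤ d → b ≡ a + d → a ≤ b
  ≤-of-nonneg-+ {a} {b} d 0≤d b≡a+d = 0≤i-j⇒j≤i (subst (0ℤ ≤_) (trans (sym (lemma a d)) (cong (_- a) (sym b≡a+d))) 0≤d)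
    where
    lemma : ∀ a d → a + d - a ≡ d
    lemma = solve-∀

  halve-nonneg : ∀ i → 0ℤ ≤ + 2 * i → 0ℤ ≤ i
  halve-nonneg i = *-cancelˡ-≤-pos 0ℤ i (+ 2)

  module _ {a} {A : Set a} where

    ∑-const : ∀ (xs : List A) k → ∑[ x ∈ xs ] k ≡ + length xs * k
    ∑-const []       k = refl
    ∑-const (x ∷ xs) k = trans (cong (_+_ k) (∑-const xs k)) (lemma k (+ length xs))
      where
      lemma : ∀ k m → k + m * k ≡ (1ℤ + m) * k
      lemma = solve-∀

    ∑-distrib-- : ∀ xs (f g : A → ℤ) → ∑[ x ∈ xs ] (f x - g x) ≡ ∑ xs f - ∑ xs g
    ∑-distrib-- []       f g = refl
    ∑-distrib-- (x ∷ xs) f g = trans (cong (_+_ (f x - g x)) (∑-distrib-- xs f g)) (lemma (f x) (g x) _ _)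
      where
      lemma : ∀ a b c d → a - b + (c - d) ≡ a + c - (b + d)
      lemma = solve-∀

    ∑-mono-≤ : ∀ xs {f g : A → ℤ} → (∀ x → f x ≤ g x) → ∑ xs f ≤ ∑ xs g
    ∑-mono-≤ []       f≤g = ≤-refl
    ∑-mono-≤ (x ∷ xs) f≤g = +-mono-≤ (f≤g x) (∑-mono-≤ xs f≤g)

    ∑-nonneg : ∀ xs {f : A → ℤ} → (∀ x → 0ℤ ≤ f x) → 0ℤ ≤ ∑ xs f
    ∑-nonneg xs {f} 0≤f = subst (_≤ ∑ xs f) (∑-zero xs) (∑-mono-≤ xs 0≤f)

    cov : List A → (A → ℤ) → (A → ℤ) → ℤ
    cov xs f g = + length xs * ∑[ x ∈ xs ] (f x * g x) - ∑ xs f * ∑ xs g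

    -- σ xs f is the sum of (f x − f y)² over unordered pairs (see ∑∑-square-diff).
    σ : List A → (A → ℤ) → ℤ
    σ xs f = cov xs f f

    cov-centred : ∀ xs (g f : A → ℤ) → cov xs g f ≡ ∑[ x ∈ xs ] (g x * (+ length xs * f x - ∑ xs f))
    cov-centred xs g f = sym (begin
      ∑[ x ∈ xs ] (g x * (N * f x - F))         ≡⟨ ∑-cong xs (λ x → lemma N F (g x) (f x)) ⟩
      ∑[ x ∈ xs ] (N * (g x * f x) - g x * F)   ≡⟨ ∑-distrib-- xs _ _ ⟩
      ∑[ x ∈ xs ] (N * (g x * f x)) - ∑[ x ∈ xs ] (g x * F)
        ≡⟨ cong₂ _-_ (sym (*-distribˡ-∑ N xs _)) (sym (*-distribʳ-∑ F xs g)) ⟩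
      cov xs g f                                ∎)
      where
      open ≡-Reasoning
      N = + length xs
      F = ∑ xs f
      lemma : ∀ N F a b → a * (N * b - F) ≡ N * (a * b) - a * F
      lemma = solve-∀

    ∑∑-square-diff : ∀ xs (f : A → ℤ) → ∑[ x ∈ xs ] ∑[ y ∈ xs ] ((f x - f y) * (f x - f y)) ≡ + 2 * σ xs f
    ∑∑-square-diff xs f = begin
      ∑[ x ∈ xs ] ∑[ y ∈ xs ] ((f x - f y) * (f x - f y))
        ≡⟨ ∑-cong xs (λ x → ∑-cong xs (λ y → expand (f x) (f y))) ⟩
      ∑[ x ∈ xs ] ∑[ y ∈ xs ] (f x * f x - (f x * f y + f x * f y) + f y * f y)
        ≡⟨ ∑-cong xs (λ x → inner x) ⟩
      ∑[ x ∈ xs ] (N * (f x * f x) - (f x * F + f x * F) + Q)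
        ≡⟨ trans (∑-distrib-+ xs _ (λ _ → Q)) (cong₂ _+_ (∑-distrib-- xs _ _) (∑-const xs Q)) ⟩
      ∑[ x ∈ xs ] (N * (f x * f x)) - ∑[ x ∈ xs ] (f x * F + f x * F) + N * Q
        ≡⟨ cong (λ t → t + N * Q) (cong₂ _-_ (sym (*-distribˡ-∑ N xs _))
             (trans (∑-distrib-+ xs _ _) (cong₂ _+_ (sym (*-distribʳ-∑ F xs f)) (sym (*-distribʳ-∑ F xs f))))) ⟩
      N * Q - (F * F + F * F) + N * Q   ≡⟨ double N Q F ⟩
      + 2 * σ xs f                       ∎
      where
      open ≡-Reasoning
      N = + length xs
      F = ∑ xs f
      Q = ∑[ x ∈ xs ] (f x * f x)
      expand : ∀ a b → (a - b) * (a - b) ≡ a * a - (a * b + a * b) + b * b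
      expand = solve-∀
      double : ∀ N Q F → N * Q - (F * F + F * F) + N * Q ≡ + 2 * (N * Q - F * F)
      double = solve-∀
      inner : ∀ x → ∑[ y ∈ xs ] (f x * f x - (f x * f y + f x * f y) + f y * f y)
                  ≡ N * (f x * f x) - (f x * F + f x * F) + Q
      inner x = begin
        ∑[ y ∈ xs ] (f x * f x - (f x * f y + f x * f y) + f y * f y)
          ≡⟨ ∑-distrib-+ xs _ _ ⟩
        ∑[ y ∈ xs ] (f x * f x - (f x * f y + f x * f y)) + Q
          ≡⟨ cong (_+ Q) (∑-distrib-- xs _ _) ⟩
        ∑[ y ∈ xs ] (f x * f x) - ∑[ y ∈ xs ] (f x * f y + f x * f y) + Q
          ≡⟨ cong (λ t → t + Q) (cong₂ _-_ (∑-const xs _)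
               (trans (∑-distrib-+ xs _ _) (cong₂ _+_ (sym (*-distribˡ-∑ (f x) xs f)) (sym (*-distribˡ-∑ (f x) xs f))))) ⟩
        N * (f x * f x) - (f x * F + f x * F) + Q ∎

    σ-nonneg : ∀ xs (f : A → ℤ) → 0ℤ ≤ σ xs f
    σ-nonneg xs f = halve-nonneg (σ xs f) (subst (0ℤ ≤_) (∑∑-square-diff xs f)
      (∑-nonneg xs (λ x → ∑-nonneg xs (λ y → square-nonneg (f x - f y)))))

    σ-diff : ∀ xs (g f : A → ℤ) → σ xs (λ x → g x - f x) ≡ σ xs g - + 2 * cov xs g f + σ xs f
    σ-diff xs g f = begin
      N * ∑[ x ∈ xs ] ((g x - f x) * (g x - f x)) - ∑[ x ∈ xs ] (g x - f x) * ∑[ x ∈ xs ] (g x - f x)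
        ≡⟨ cong₂ (λ s t → N * s - t * t) squares (∑-distrib-- xs g f) ⟩
      N * (∑[ x ∈ xs ] (g x * g x) - + 2 * ∑[ x ∈ xs ] (g x * f x) + ∑[ x ∈ xs ] (f x * f x)) - (G - F) * (G - F)
        ≡⟨ lemma N (∑[ x ∈ xs ] (g x * g x)) (∑[ x ∈ xs ] (g x * f x)) (∑[ x ∈ xs ] (f x * f x)) G F ⟩
      σ xs g - + 2 * cov xs g f + σ xs f ∎
      where
      open ≡-Reasoning
      N = + length xs
      G = ∑ xs g
      F = ∑ xs f
      expand : ∀ a b → (a - b) * (a - b) ≡ a * a - + 2 * (a * b) + b * b
      expand = solve-∀
      squares : ∑[ x ∈ xs ] ((g x - f x) * (g x - f x))
                ≡ ∑[ x ∈ xs ] (g x * g x) - + 2 * ∑[ x ∈ xs ] (g x * f x) + ∑[ x ∈ xs ] (f x * f x)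
      squares = trans (∑-cong xs (λ x → expand (g x) (f x)))
        (trans (∑-distrib-+ xs _ _) (cong (_+ ∑[ x ∈ xs ] (f x * f x))
          (trans (∑-distrib-- xs _ _) (cong (_-_ (∑[ x ∈ xs ] (g x * g x))) (sym (*-distribˡ-∑ (+ 2) xs _))))))
      lemma : ∀ N gg gf ff G F → N * (gg - + 2 * gf + ff) - (G - F) * (G - F)
                                ≡ (N * gg - G * G) - + 2 * (N * gf - G * F) + (N * ff - F * F)
      lemma = solve-∀

    -- σ(g − f) ≥ 0 expands to σ g + σ f ≥ 2 cov g f ≥ 2 σ f.
    σ-mono-cov : ∀ xs (g f : A → ℤ) → σ xs f ≤ cov xs g f → σ xs f ≤ σ xs g
    σ-mono-cov xs g f σf≤cov = 0≤i-j⇒j≤i (subst (0ℤ ≤_)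
      (trans (cong (_+ (+ 2 * (cov xs g f - σ xs f))) (σ-diff xs g f)) (lemma (σ xs g) (cov xs g f) (σ xs f)))
      (+-mono-≤ (σ-nonneg xs (λ x → g x - f x)) (twice (i≤j⇒0≤j-i σf≤cov))))
      where
      lemma : ∀ s c t → (s - + 2 * c + t) + (+ 2 * (c - t)) ≡ s - t
      lemma = solve-∀
      twice : ∀ {i} → 0ℤ ≤ i → 0ℤ ≤ + 2 * i
      twice = *-monoˡ-≤-nonNeg (+ 2)

  σ-map : ∀ {a b} {A : Set a} {B : Set b} (g : A → B) xs (f : B → ℤ) → σ (map g xs) f ≡ σ xs (λ x → f (g x))
  σ-map g xs f rewrite length-map g xs | ∑-map g xs f | ∑-map g xs (λ y → f y * f y) = refl

module DegreeSums where

  open import Data.Bool using (Bool; true; false; if_then_else_; T)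
  import Data.Bool.Properties as Bool
  open import Data.Empty using (⊥-elim)
  open import Data.Fin using (Fin; zero; suc; toℕ)
  open import Data.Fin.Properties using (toℕ-injective; _≟_)
  open import Data.Integer using (ℤ; +_; 0ℤ; 1ℤ; _+_; _*_; _-_)
  open import Data.Integer.Properties using (pos-*; *-cancelˡ-≡; +-identityʳ; +-identityˡ)
  open import Data.Integer.Tactic.RingSolver using (solve-∀)
  open import Data.List using ([]; _∷_; _++_; map; filter; length; concatMap; allFin)
  open import Data.List.Properties using (length-tabulate; map-tabulate)
  open import Data.Nat as ℕ using (ℕ; zero; suc; _<ᵇ_)
  import Data.Nat.Properties as ℕ
  open import Data.Nat.ListAction using (sum)
  open import Data.Nat.ListAction.Properties using (sum-++)
  open import Function using (id; _∘_)
  open import Relation.Nullary using (does)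
  open import Relation.Unary using (Pred; Decidable)
  open import Relation.Binary.PropositionalEquality using (_≡_; refl; sym; trans; cong; cong₂; subst; module ≡-Reasoning)

  open import Defs using (Graph; adj; degree; sigmaT)
  open Variance

  length-allFin : ∀ n → length (allFin n) ≡ n
  length-allFin n = length-tabulate id

  ∑-allFin-const : ∀ n k → ∑[ _ ∈ allFin n ] k ≡ + n * k
  ∑-allFin-const n k = trans (∑-const (allFin n) k) (cong (λ m → + m * k) (length-allFin n))

  σ-allFin : ∀ {n} (f : Fin n → ℤ) → σ (allFin n) f ≡ + n * ∑[ u ∈ allFin n ] (f u * f u) - ∑ (allFin n) f * ∑ (allFin n) f
  σ-allFin {n} f = cong (λ m → + m * ∑[ u ∈ allFin n ] (f u * f u) - ∑ (allFin n) f * ∑ (allFin n) f) (length-allFin n)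

  𝟙 : Bool → ℤ
  𝟙 b = if b then 1ℤ else 0ℤ

  length-filter≡∑ : ∀ {a p} {A : Set a} {P : Pred A p} (P? : Decidable P) xs →
                    + length (filter P? xs) ≡ ∑[ x ∈ xs ] 𝟙 (does (P? x))
  length-filter≡∑ P? []       = refl
  length-filter≡∑ P? (x ∷ xs) with does (P? x)
  ... | true  = cong (_+_ 1ℤ) (length-filter≡∑ P? xs)
  ... | false = trans (length-filter≡∑ P? xs) (sym (+-identityˡ _))

  sum-concatMap≡∑∑ : ∀ {a b} {A : Set a} {B : Set b} xs ys (f : A → B → ℕ) →
                     + sum (concatMap (λ x → map (f x) ys) xs) ≡ ∑[ x ∈ xs ] ∑[ y ∈ ys ] (+ f x y)
  sum-concatMap≡∑∑ []       ys f = refl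
  sum-concatMap≡∑∑ (x ∷ xs) ys f = begin
    + sum (map (f x) ys ++ concatMap (λ x → map (f x) ys) xs)
      ≡⟨ cong +_ (sum-++ (map (f x) ys) _) ⟩
    + sum (map (f x) ys) + + sum (concatMap (λ x → map (f x) ys) xs)
      ≡⟨ cong₂ _+_ (sum-map ys) (sum-concatMap≡∑∑ xs ys f) ⟩
    ∑[ y ∈ ys ] (+ f x y) + ∑[ x ∈ xs ] ∑[ y ∈ ys ] (+ f x y) ∎
    where
    open ≡-Reasoning
    sum-map : ∀ zs → + sum (map (f x) zs) ≡ ∑[ y ∈ zs ] (+ f x y)
    sum-map []       = refl
    sum-map (z ∷ zs) = cong (_+_ (+ f x z)) (sum-map zs)

  ∣m-n∣²≡[m-n]² : ∀ m n → + (ℕ.∣ m - n ∣ ℕ.^ 2) ≡ (+ m - + n) * (+ m - + n)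
  ∣m-n∣²≡[m-n]² zero    n       = trans (cong +_ (cong (n ℕ.*_) (ℕ.*-identityʳ n))) (trans (pos-* n n) (lemma (+ n)))
    where
    lemma : ∀ a → a * a ≡ (0ℤ - a) * (0ℤ - a)
    lemma = solve-∀
  ∣m-n∣²≡[m-n]² (suc m) zero    =
    trans (cong +_ (cong (suc m ℕ.*_) (ℕ.*-identityʳ (suc m)))) (trans (pos-* (suc m) (suc m)) (lemma (+ suc m)))
    where
    lemma : ∀ a → a * a ≡ (a - 0ℤ) * (a - 0ℤ)
    lemma = solve-∀
  ∣m-n∣²≡[m-n]² (suc m) (suc n) = trans (∣m-n∣²≡[m-n]² m n) (lemma (+ m) (+ n))
    where
    lemma : ∀ a b → (a - b) * (a - b) ≡ ((1ℤ + a) - (1ℤ + b)) * ((1ℤ + a) - (1ℤ + b))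
    lemma = solve-∀

  module _ {n : ℕ} (φ : Fin n → Fin n → ℤ) (φ-sym : ∀ u v → φ u v ≡ φ v u) (φ-diag : ∀ u → φ u u ≡ 0ℤ) where

    private
      upper : Fin n → Fin n → ℤ
      upper u v = if toℕ u <ᵇ toℕ v then φ u v else 0ℤ

      upper+lower : ∀ u v → upper u v + upper v u ≡ φ u v
      upper+lower u v with toℕ u <ᵇ toℕ v in u<v | toℕ v <ᵇ toℕ u in v<u
      ... | true  | true  =
        ⊥-elim (ℕ.<-asym (ℕ.<ᵇ⇒< (toℕ u) (toℕ v) (subst T (sym u<v) _)) (ℕ.<ᵇ⇒< (toℕ v) (toℕ u) (subst T (sym v<u) _)))
      ... | true  | false = +-identityʳ _
      ... | false | true  = trans (+-identityˡ _) (φ-sym v u)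
      ... | false | false =
        trans (sym (φ-diag u)) (cong (φ u) (toℕ-injective (ℕ.≤-antisym (≮ (toℕ v) (toℕ u) v<u) (≮ (toℕ u) (toℕ v) u<v))))
        where
        ≮ : ∀ i j → (i <ᵇ j) ≡ false → j ℕ.≤ i
        ≮ i j i≮j = ℕ.≮⇒≥ (λ i<j → subst T i≮j (ℕ.<⇒<ᵇ i<j))

    ∑∑-upper : + 2 * ∑[ u ∈ allFin n ] ∑[ v ∈ allFin n ] upper u v ≡ ∑[ u ∈ allFin n ] ∑[ v ∈ allFin n ] φ u v
    ∑∑-upper = begin
      + 2 * U                                                            ≡⟨ two U ⟩
      U + U                                                              ≡⟨ cong (_+_ U) (∑-comm (allFin n) (allFin n) upper) ⟩
      U + ∑[ u ∈ allFin n ] ∑[ v ∈ allFin n ] upper v u                   ≡⟨ ∑-distrib-+ (allFin n) _ _ ⟨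
      ∑[ u ∈ allFin n ] (∑ (allFin n) (upper u) + ∑[ v ∈ allFin n ] upper v u)
        ≡⟨ ∑-cong (allFin n) (λ u → trans (sym (∑-distrib-+ (allFin n) _ _)) (∑-cong (allFin n) (upper+lower u))) ⟩
      ∑[ u ∈ allFin n ] ∑[ v ∈ allFin n ] φ u v                           ∎
      where
      open ≡-Reasoning
      U = ∑[ u ∈ allFin n ] ∑[ v ∈ allFin n ] upper u v
      two : ∀ a → + 2 * a ≡ a + a
      two = solve-∀

  ∑-allFin-suc : ∀ {n} (f : Fin (ℕ.suc n) → ℤ) → ∑ (allFin (ℕ.suc n)) f ≡ f zero + ∑[ v ∈ allFin n ] f (suc v)
  ∑-allFin-suc {n} f = cong (_+_ (f zero)) (trans (cong (λ vs → ∑ vs f) (sym (map-tabulate id suc))) (∑-map suc (allFin n) f))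

  ∑-punctured : ∀ {n} (u : Fin n) (f : Fin n → ℤ) →
                ∑[ v ∈ allFin n ] (if does (u ≟ v) then 0ℤ else f v) ≡ ∑ (allFin n) f - f u
  ∑-punctured {ℕ.suc n} zero f = trans (∑-allFin-suc (λ v → if does (zero ≟ v) then 0ℤ else f v))
    (trans (lemma (f zero) (∑[ v ∈ allFin n ] f (suc v))) (cong (_- f zero) (sym (∑-allFin-suc f))))
    where
    lemma : ∀ a s → 0ℤ + s ≡ a + s - a
    lemma = solve-∀
  ∑-punctured {ℕ.suc n} (suc u) f = begin
    ∑[ v ∈ allFin (ℕ.suc n) ] (if does (suc u ≟ v) then 0ℤ else f v)
      ≡⟨ ∑-allFin-suc (λ v → if does (suc u ≟ v) then 0ℤ else f v) ⟩
    f zero + ∑[ v ∈ allFin n ] (if does (u ≟ v) then 0ℤ else f (suc v))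
      ≡⟨ cong (_+_ (f zero)) (∑-punctured u (f ∘ suc)) ⟩
    f zero + (∑[ v ∈ allFin n ] f (suc v) - f (suc u))
      ≡⟨ lemma (f zero) _ (f (suc u)) ⟩
    (f zero + ∑[ v ∈ allFin n ] f (suc v)) - f (suc u)
      ≡⟨ cong (_- f (suc u)) (∑-allFin-suc f) ⟨
    ∑ (allFin (ℕ.suc n)) f - f (suc u) ∎
    where
    open ≡-Reasoning
    lemma : ∀ a s b → a + (s - b) ≡ (a + s) - b
    lemma = solve-∀

  module Degrees {n : ℕ} (G : Graph n) where

    adjacency : Fin n → Fin n → ℤ
    adjacency u v = 𝟙 (adj G u v)

    deg : Fin n → ℤ
    deg u = + degree G u

    deg≡∑adjacency : ∀ u → deg u ≡ ∑[ v ∈ allFin n ] adjacency u v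
    deg≡∑adjacency u = trans (length-filter≡∑ (λ v → adj G u v Bool.≟ true) (allFin n))
                             (∑-cong (allFin n) (λ v → indicator (adj G u v)))
      where
      indicator : ∀ b → 𝟙 (does (b Bool.≟ true)) ≡ 𝟙 b
      indicator true  = refl
      indicator false = refl

    sigmaT≡σ : + sigmaT G ≡ σ (allFin n) deg
    sigmaT≡σ = *-cancelˡ-≡ (+ 2) _ _ (begin
      + 2 * + sigmaT G
        ≡⟨ cong (+ 2 *_) (sum-concatMap≡∑∑ (allFin n) (allFin n) _) ⟩
      + 2 * ∑[ u ∈ allFin n ] ∑[ v ∈ allFin n ] (+ (if toℕ u <ᵇ toℕ v then ℕ.∣ degree G u - degree G v ∣ ℕ.^ 2 else 0))
        ≡⟨ cong (+ 2 *_) (∑-cong (allFin n) (λ u → ∑-cong (allFin n) (λ v → cast u v))) ⟩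
      + 2 * ∑[ u ∈ allFin n ] ∑[ v ∈ allFin n ] (if toℕ u <ᵇ toℕ v then sqdiff u v else 0ℤ)
        ≡⟨ ∑∑-upper sqdiff (λ u v → lemma (deg u) (deg v)) (λ u → diag (deg u)) ⟩
      ∑[ u ∈ allFin n ] ∑[ v ∈ allFin n ] sqdiff u v
        ≡⟨ ∑∑-square-diff (allFin n) deg ⟩
      + 2 * σ (allFin n) deg ∎)
      where
      open ≡-Reasoning
      sqdiff : Fin n → Fin n → ℤ
      sqdiff u v = (deg u - deg v) * (deg u - deg v)
      cast : ∀ u v → + (if toℕ u <ᵇ toℕ v then ℕ.∣ degree G u - degree G v ∣ ℕ.^ 2 else 0)
                     ≡ (if toℕ u <ᵇ toℕ v then sqdiff u v else 0ℤ)
      cast u v with toℕ u <ᵇ toℕ v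
      ... | true  = ∣m-n∣²≡[m-n]² (degree G u) (degree G v)
      ... | false = refl
      lemma : ∀ a b → (a - b) * (a - b) ≡ (b - a) * (b - a)
      lemma = solve-∀
      diag : ∀ a → (a - a) * (a - a) ≡ 0ℤ
      diag = solve-∀

module ThresholdGraphs where

  open import Data.Bool using (true; false; if_then_else_)
  open import Data.Empty using (⊥-elim)
  open import Data.Fin using (Fin)
  open import Data.Fin.Properties using (_≟_)
  open import Data.Integer using (ℤ; +_; 0ℤ; _+_; _*_; _-_; _≤_; _⊓_; +≤+)
  open import Data.Integer.Properties
    using (_<?_; ≤-refl; ≤-reflexive; ≤-trans; <⇒≤; ≮⇒≥; *-identityˡ; *-cancelˡ-≤-pos; +-comm; <-≤-trans;
           +-mono-<; +-mono-≤; <-irrefl; mono-≤-distrib-⊓; module ≤-Reasoning)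
  open import Data.Integer.Tactic.RingSolver using (solve-∀)
  open import Data.List using (allFin; length)
  open import Data.Nat using (ℕ; z≤n)
  open import Relation.Nullary using (Dec; yes; no; does)
  open import Relation.Binary.PropositionalEquality using (_≡_; refl; sym; trans; cong; module ≡-Reasoning)

  open import Defs using (Graph; adj; irrefl) renaming (sym to adj-sym)
  open Variance
  open DegreeSums

  θ : ℤ → ℤ
  θ s = 𝟙 (does (0ℤ <? s))

  s≤θs*s : ∀ s → s ≤ θ s * s
  s≤θs*s s with 0ℤ <? s
  ... | yes _  = ≤-reflexive (sym (*-identityˡ s))
  ... | no s≯0 = ≮⇒≥ s≯0

  0≤θs*s : ∀ s → 0ℤ ≤ θ s * s
  0≤θs*s s with 0ℤ <? s
  ... | yes 0<s = ≤-trans (<⇒≤ 0<s) (≤-reflexive (sym (*-identityˡ s)))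
  ... | no  _   = ≤-refl

  θ-mono : ∀ {a b} → a ≤ b → θ a ≤ θ b
  θ-mono {a} {b} a≤b with 0ℤ <? a | 0ℤ <? b
  ... | yes _   | yes _   = ≤-refl
  ... | yes 0<a | no  0≮b = ⊥-elim (0≮b (<-≤-trans 0<a a≤b))
  ... | no  _   | yes _   = +≤+ z≤n
  ... | no  _   | no  _   = ≤-refl

  θ-⊓ : ∀ a b → θ (a ⊓ b) ≡ θ a * θ b
  θ-⊓ a b = trans (mono-≤-distrib-⊓ θ-mono a b) (min≡product (0ℤ <? a) (0ℤ <? b))
    where
    min≡product : ∀ {p q} (p? : Dec p) (q? : Dec q) → 𝟙 (does p?) ⊓ 𝟙 (does q?) ≡ 𝟙 (does p?) * 𝟙 (does q?)
    min≡product (yes _) (yes _) = refl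
    min≡product (yes _) (no  _) = refl
    min≡product (no  _) (yes _) = refl
    min≡product (no  _) (no  _) = refl

  θ-double : ∀ y → θ (y + y) ≡ θ y
  θ-double y with 0ℤ <? y | 0ℤ <? y + y
  ... | yes _   | yes _     = refl
  ... | yes 0<y | no  0≮2y  = ⊥-elim (0≮2y (+-mono-< 0<y 0<y))
  ... | no  0≮y | yes 0<2y  = ⊥-elim (<-irrefl refl (<-≤-trans 0<2y (+-mono-≤ (≮⇒≥ 0≮y) (≮⇒≥ 0≮y))))
  ... | no  _   | no  _     = refl

  module _ {n : ℕ} where

    ∑∑-sym-weights : (M : Fin n → Fin n → ℤ) → (∀ u v → M u v ≡ M v u) → (y : Fin n → ℤ) →
                     ∑[ u ∈ allFin n ] ∑[ v ∈ allFin n ] (M u v * (y u + y v))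
                     ≡ + 2 * ∑[ u ∈ allFin n ] (∑ (allFin n) (M u) * y u)
    ∑∑-sym-weights M M-sym y = begin
      ∑[ u ∈ allFin n ] ∑[ v ∈ allFin n ] (M u v * (y u + y v))
        ≡⟨ ∑-cong V (λ u → trans (∑-cong V (λ v → *-distribˡ-+′ (M u v) (y u) (y v))) (∑-distrib-+ V _ _)) ⟩
      ∑[ u ∈ allFin n ] (∑[ v ∈ allFin n ] (M u v * y u) + ∑[ v ∈ allFin n ] (M u v * y v))
        ≡⟨ ∑-distrib-+ V _ _ ⟩
      W + ∑[ u ∈ allFin n ] ∑[ v ∈ allFin n ] (M u v * y v)
        ≡⟨ cong (_+_ W) (∑-comm V V (λ u v → M u v * y v)) ⟩
      W + ∑[ v ∈ allFin n ] ∑[ u ∈ allFin n ] (M u v * y v)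
        ≡⟨ cong (_+_ W) (∑-cong V (λ v → ∑-cong V (λ u → cong (_* y v) (M-sym u v)))) ⟩
      W + W
        ≡⟨ double W ⟩
      + 2 * W
        ≡⟨ cong (+ 2 *_) (∑-cong V (λ u → sym (*-distribʳ-∑ (y u) V (M u)))) ⟩
      + 2 * ∑[ u ∈ allFin n ] (∑ (allFin n) (M u) * y u) ∎
      where
      open ≡-Reasoning
      V = allFin n
      W = ∑[ u ∈ V ] ∑[ v ∈ V ] (M u v * y u)
      *-distribˡ-+′ : ∀ a b c → a * (b + c) ≡ a * b + a * c
      *-distribˡ-+′ = solve-∀
      double : ∀ a → a + a ≡ + 2 * a
      double = solve-∀

    thresholdAdj : (Fin n → ℤ) → Fin n → Fin n → ℤ
    thresholdAdj x u v = if does (u ≟ v) then 0ℤ else θ (x u + x v)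

    thresholdDeg : (Fin n → ℤ) → Fin n → ℤ
    thresholdDeg x u = ∑ (allFin n) (thresholdAdj x u)

    thresholdAdj-sym : ∀ x u v → thresholdAdj x u v ≡ thresholdAdj x v u
    thresholdAdj-sym x u v with u ≟ v | v ≟ u
    ... | yes _   | yes _   = refl
    ... | yes u≡v | no  v≢u = ⊥-elim (v≢u (sym u≡v))
    ... | no  u≢v | yes v≡u = ⊥-elim (u≢v (sym v≡u))
    ... | no  _   | no  _   = cong θ (+-comm (x u) (x v))

    module _ (G : Graph n) where
      open Degrees G

      centred : Fin n → ℤ
      centred u = + length (allFin n) * deg u - ∑ (allFin n) deg

      adjacency-weight≤threshold : ∀ x u v → adjacency u v * (x u + x v) ≤ thresholdAdj x u v * (x u + x v)
      adjacency-weight≤threshold x u v with u ≟ v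
      ... | yes refl = ≤-reflexive (cong (λ b → 𝟙 b * (x u + x u)) (irrefl G u))
      ... | no  _ with adj G u v
      ...   | true  = ≤-trans (≤-reflexive (*-identityˡ _)) (s≤θs*s (x u + x v))
      ...   | false = 0≤θs*s (x u + x v)

      -- For the degrees w of any graph, cov(w, deg) is the sum over its edges uv of
      -- centred u + centred v; the threshold graph keeps exactly the edges with a positive summand.
      σ-deg≤σ-thresholdDeg : σ (allFin n) deg ≤ σ (allFin n) (thresholdDeg centred)
      σ-deg≤σ-thresholdDeg = σ-mono-cov (allFin n) (thresholdDeg centred) deg (*-cancelˡ-≤-pos _ _ (+ 2) (begin
        + 2 * σ (allFin n) deg
          ≡⟨ cong (+ 2 *_) (trans (cov-centred V deg deg) (∑-cong V (λ u → cong (_* centred u) (deg≡∑adjacency u)))) ⟩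
        + 2 * ∑[ u ∈ V ] (∑ V (adjacency u) * centred u)
          ≡⟨ ∑∑-sym-weights adjacency (λ u v → cong 𝟙 (adj-sym G u v)) centred ⟨
        ∑[ u ∈ V ] ∑[ v ∈ V ] (adjacency u v * (centred u + centred v))
          ≤⟨ ∑-mono-≤ V (λ u → ∑-mono-≤ V (λ v → adjacency-weight≤threshold centred u v)) ⟩
        ∑[ u ∈ V ] ∑[ v ∈ V ] (thresholdAdj centred u v * (centred u + centred v))
          ≡⟨ ∑∑-sym-weights (thresholdAdj centred) (thresholdAdj-sym centred) centred ⟩
        + 2 * ∑[ u ∈ V ] (thresholdDeg centred u * centred u)
          ≡⟨ cong (+ 2 *_) (cov-centred V (thresholdDeg centred) deg) ⟨
        + 2 * cov V (thresholdDeg centred) deg ∎))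
        where
        open ≤-Reasoning
        V = allFin n

module FerrersDiagrams where

  open import Data.List using (List; []; _∷_; map; length)
  open import Data.List.Relation.Unary.All as All using (All; []; _∷_)
  import Data.List.Relation.Unary.All.Properties as All
  open import Data.List.Relation.Binary.Permutation.Propositional as ↭ using (_↭_; prep; swap)
  open import Data.List.Relation.Binary.Permutation.Propositional.Properties using (All-resp-↭)
  open import Data.Nat using (ℕ; zero; suc; pred; _+_; _*_; _⊓_; _≤_; _<_; _≤?_; z≤n; s≤s; NonZero; >-nonZero)
  open import Data.Nat.Properties
  open import Data.Nat.Induction using (<-wellFounded)
  open import Data.Nat.Tactic.RingSolver using (solve-∀)
  open import Data.Product using (∃₂; _×_; _,_)
  open import Induction.WellFounded using (Acc; acc)
  open import Relation.Nullary using (yes; no; ¬_)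
  open import Relation.Binary.PropositionalEquality using (_≡_; refl; sym; trans; cong; cong₂; subst; subst₂; module ≡-Reasoning)

  open FiniteSums +-*-commutativeSemiring

  -- A list of naturals is read as the row lengths of a Ferrers diagram, in any order.
  -- Since a ⊓ b counts the columns met by both rows a and b, ∑∑ (a ⊓ b) is the sum of the
  -- squared column lengths, and squares L that of the squared row and column lengths.
  cells : List ℕ → ℕ
  cells L = ∑[ a ∈ L ] a

  squares : List ℕ → ℕ
  squares L = ∑[ a ∈ L ] (a * a) + ∑[ a ∈ L ] ∑[ b ∈ L ] (a ⊓ b)

  firstColumn : List ℕ → ℕ
  firstColumn L = ∑[ a ∈ L ] (1 ⊓ a)

  -- the squares of α full rows of length K together with one row of length ρ
  greedySquares : ℕ → ℕ → ℕ → ℕ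
  greedySquares K α ρ = α * K * K + α * α * K + ρ * ρ + (2 * α + 1) * ρ

  record GreedyBound (K R Q : ℕ) : Set where
    constructor greedy
    field
      full partial : ℕ
      partial<K    : partial < K
      full≤K       : full ≤ K
      cells≡       : R ≡ full * K + partial
      squares≤     : Q ≤ greedySquares K full partial

  GreedyBound-addRow : ∀ {K R Q} → 1 ≤ K → K + R ≤ K * K →
                       GreedyBound K R Q → GreedyBound K (K + R) (Q + (K * K + K + 2 * R))
  GreedyBound-addRow {K} {R} {Q} 1≤K K+R≤K² (greedy α ρ ρ<K α≤K refl Q≤) =
    greedy (suc α) ρ ρ<K 1+α≤K (sym (+-assoc K (α * K) ρ)) (begin
      Q + (K * K + K + 2 * (α * K + ρ))                    ≤⟨ +-monoˡ-≤ _ Q≤ ⟩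
      greedySquares K α ρ + (K * K + K + 2 * (α * K + ρ))  ≡⟨ addRow K α ρ ⟨
      greedySquares K (suc α) ρ                            ∎)
    where
    open ≤-Reasoning
    instance
      K≢0 : NonZero K
      K≢0 = >-nonZero 1≤K
    1+α≤K : suc α ≤ K
    1+α≤K = *-cancelʳ-≤ (suc α) K K (≤-trans (m≤m+n (suc α * K) ρ)
              (subst (_≤ K * K) (sym (+-assoc K (α * K) ρ)) K+R≤K²))
    addRow : ∀ K a r → (1 + a) * K * K + (1 + a) * (1 + a) * K + r * r + (2 * (1 + a) + 1) * r
                       ≡ a * K * K + a * a * K + r * r + (2 * a + 1) * r + (K * K + K + 2 * (a * K + r))
    addRow = solve-∀

  GreedyBound-widen : ∀ {K R Q} → GreedyBound K R Q → GreedyBound (suc K) R Q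
  GreedyBound-widen (greedy α ρ ρ<K α≤K R≡ Q≤) with α ≤? ρ
  ... | yes α≤ρ with m≤n⇒∃[o]m+o≡n α≤ρ | m≤n⇒∃[o]m+o≡n ρ<K
  ...   | d , refl | e , refl =
    greedy α d (s≤s (≤-trans (m≤n+m d α) (≤-trans (n≤1+n _) (m≤m+n _ e))))
      (m≤n⇒m≤1+n α≤K) (trans R≡ (regroup α d e))
      (≤-trans Q≤ (≤-trans (m≤m+n (greedySquares (suc (α + d + e)) α (α + d)) _) (≤-reflexive (squares≡ α d e))))
    where
    regroup : ∀ a d e → a * (1 + (a + d + e)) + (a + d) ≡ a * (1 + (1 + (a + d + e))) + d
    regroup = solve-∀
    squares≡ : ∀ a d e → let K = 1 + (a + d + e) in
               a * K * K + a * a * K + (a + d) * (a + d) + (2 * a + 1) * (a + d) + 2 * a * (1 + e)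
               ≡ a * (1 + K) * (1 + K) + a * a * (1 + K) + d * d + (2 * a + 1) * d
    squares≡ = solve-∀
  GreedyBound-widen (greedy α ρ ρ<K α≤K R≡ Q≤) | no α≰ρ with m≤n⇒∃[o]m+o≡n (≰⇒> α≰ρ) | m≤n⇒∃[o]m+o≡n α≤K
  ...   | d , refl | e , refl =
    greedy (ρ + d) (suc ρ + e) (s≤s (s≤s (+-monoˡ-≤ e (m≤m+n ρ d))))
      (≤-trans (m≤m+n (ρ + d) (suc e)) (≤-trans (≤-reflexive (+-suc (ρ + d) e)) (n≤1+n _)))
      (trans R≡ (regroup ρ d e))
      (≤-trans Q≤ (≤-trans (m≤m+n (greedySquares (suc (ρ + d) + e) (suc (ρ + d)) ρ) _) (≤-reflexive (squares≡ ρ d e))))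
    where
    regroup : ∀ r d e → (1 + (r + d)) * (1 + (r + d) + e) + r ≡ (r + d) * (1 + (1 + (r + d) + e)) + (1 + r + e)
    regroup = solve-∀
    squares≡ : ∀ r d e → let K = 1 + (r + d) + e ; a = 1 + (r + d) in
               a * K * K + a * a * K + r * r + (2 * a + 1) * r + 2 * r * e
               ≡ (r + d) * (1 + K) * (1 + K) + (r + d) * (r + d) * (1 + K) + (1 + r + e) * (1 + r + e)
                 + (2 * (r + d) + 1) * (1 + r + e)
    squares≡ = solve-∀

  GreedyBound-mono : ∀ {K K′ R Q} → K ≤ K′ → GreedyBound K R Q → GreedyBound K′ R Q
  GreedyBound-mono {K} {R = R} {Q} K≤K′ b with m≤n⇒∃[o]m+o≡n K≤K′
  ... | d , refl = widenBy d b
    where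
    widenBy : ∀ d → GreedyBound K R Q → GreedyBound (K + d) R Q
    widenBy zero    b = subst (λ k → GreedyBound k R Q) (sym (+-identityʳ K)) b
    widenBy (suc d) b = subst (λ k → GreedyBound k R Q) (sym (+-suc K d)) (GreedyBound-widen (widenBy d b))

  cells-↭ : ∀ {L L′} → L ↭ L′ → cells L ≡ cells L′
  cells-↭ p = ∑-↭ p (λ a → a)

  firstColumn-↭ : ∀ {L L′} → L ↭ L′ → firstColumn L ≡ firstColumn L′
  firstColumn-↭ p = ∑-↭ p (1 ⊓_)

  squares-↭ : ∀ {L L′} → L ↭ L′ → squares L ≡ squares L′
  squares-↭ {L} {L′} p = cong₂ _+_ (∑-↭ p (λ a → a * a))
    (trans (∑-↭ p (λ a → ∑ L (a ⊓_))) (∑-cong L′ (λ a → ∑-↭ p (a ⊓_))))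

  extractMax : ∀ a L → ∃₂ λ m rest → (a ∷ L) ↭ (m ∷ rest) × All (_≤ m) rest
  extractMax a []      = a , [] , ↭.refl , []
  extractMax a (b ∷ L) with extractMax b L
  ... | m , rest , p , rest≤m with m ≤? a
  ...   | yes m≤a = a , m ∷ rest , prep a p , m≤a ∷ All.map (λ x≤m → ≤-trans x≤m m≤a) rest≤m
  ...   | no  m≰a = m , a ∷ rest , ↭.trans (prep a p) (swap a m ↭.refl) , <⇒≤ (≰⇒> m≰a) ∷ rest≤m

  cells≤firstColumn* : ∀ {m} L → All (_≤ m) L → cells L ≤ firstColumn L * m
  cells≤firstColumn* {m} []            []           = z≤n
  cells≤firstColumn* {m} (zero  ∷ L)   (_ ∷ L≤m)    = cells≤firstColumn* L L≤m
  cells≤firstColumn* {m} (suc a ∷ L)   (a≤m ∷ L≤m)  = +-mono-≤ a≤m (cells≤firstColumn* L L≤m)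

  firstColumn≤length : ∀ L → firstColumn L ≤ length L
  firstColumn≤length []      = z≤n
  firstColumn≤length (zero  ∷ L) = m≤n⇒m≤1+n (firstColumn≤length L)
  firstColumn≤length (suc a ∷ L) = s≤s (firstColumn≤length L)

  cells≤length* : ∀ {m} L → All (_≤ m) L → cells L ≤ length L * m
  cells≤length* {m} L L≤m = ≤-trans (cells≤firstColumn* L L≤m) (*-monoˡ-≤ m (firstColumn≤length L))

  empty-rows : ∀ L → All (_≤ 0) L → cells L ≡ 0 × squares L ≡ 0
  empty-rows L L≤0 = ∑-zero′ (λ a → a) (λ a≤0 → n≤0⇒n≡0 a≤0)
                   , cong₂ _+_ (∑-zero′ (λ a → a * a) (λ { z≤n → refl }))
                               (∑-zero′ (λ a → ∑ L (a ⊓_)) (λ { z≤n → ∑-zero L }))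
    where
    ∑-zero′ : ∀ (f : ℕ → ℕ) → (∀ {a} → a ≤ 0 → f a ≡ 0) → ∑ L f ≡ 0
    ∑-zero′ f f0 = trans (∑-congᴬ (All.map f0 L≤0)) (∑-zero L)

  squares-removeRow : ∀ m rest → All (_≤ m) rest →
                      squares (m ∷ rest) ≡ squares rest + (m * m + m + 2 * cells rest)
  squares-removeRow m rest rest≤m = begin
    (m * m + S₁) + ((m ⊓ m + ∑[ b ∈ rest ] (m ⊓ b)) + ∑[ a ∈ rest ] (a ⊓ m + ∑[ b ∈ rest ] (a ⊓ b)))
      ≡⟨ cong (λ t → (m * m + S₁) + t) (cong₂ _+_ (cong₂ _+_ (⊓-idem m) (∑-congᴬ (All.map m≥n⇒m⊓n≡n rest≤m)))
           (trans (∑-distrib-+ rest _ _) (cong (_+ S₂) (∑-congᴬ (All.map m≤n⇒m⊓n≡m rest≤m))))) ⟩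
    (m * m + S₁) + ((m + cells rest) + (cells rest + S₂))
      ≡⟨ rearrange (m * m) S₁ m (cells rest) S₂ ⟩
    squares rest + (m * m + m + 2 * cells rest) ∎
    where
    open ≡-Reasoning
    S₁ = ∑[ a ∈ rest ] (a * a)
    S₂ = ∑[ a ∈ rest ] ∑[ b ∈ rest ] (a ⊓ b)
    rearrange : ∀ mm s₁ m c s₂ → (mm + s₁) + ((m + c) + (c + s₂)) ≡ (s₁ + s₂) + (mm + m + 2 * c)
    rearrange = solve-∀

  cells-removeColumn : ∀ L → cells L ≡ firstColumn L + cells (map pred L)
  cells-removeColumn L = trans (∑-cong L split) (trans (∑-distrib-+ L _ _) (cong (firstColumn L +_) (sym (∑-map pred L (λ a → a)))))
    where
    split : ∀ a → a ≡ 1 ⊓ a + pred a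
    split zero    = refl
    split (suc a) = refl

  square-pred : ∀ a → a * a ≡ pred a * pred a + 2 * pred a + 1 ⊓ a
  square-pred zero    = refl
  square-pred (suc a) = lemma a
    where
    lemma : ∀ a → (1 + a) * (1 + a) ≡ a * a + 2 * a + 1
    lemma = solve-∀

  ⊓-pred : ∀ a b → a ⊓ b ≡ pred a ⊓ pred b + (1 ⊓ a) * (1 ⊓ b)
  ⊓-pred zero    b       = refl
  ⊓-pred (suc a) zero    = sym (cong (_+ 0) (⊓-zeroʳ a))
  ⊓-pred (suc a) (suc b) = +-comm 1 (a ⊓ b)

  squares-removeColumn : ∀ L → let z = firstColumn L ; L′ = map pred L in
                         squares L ≡ squares L′ + (z * z + z + 2 * cells L′)
  squares-removeColumn L = begin
    ∑[ a ∈ L ] (a * a) + ∑[ a ∈ L ] ∑[ b ∈ L ] (a ⊓ b)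
      ≡⟨ cong₂ _+_ (∑-cong L square-pred) (∑-cong L (λ a → ∑-cong L (⊓-pred a))) ⟩
    ∑[ a ∈ L ] (pred a * pred a + 2 * pred a + 1 ⊓ a)
      + ∑[ a ∈ L ] ∑[ b ∈ L ] (pred a ⊓ pred b + (1 ⊓ a) * (1 ⊓ b))
      ≡⟨ cong₂ _+_ rowPart columnPart ⟩
    (S₁ + 2 * cells L′ + z) + (S₂ + z * z)
      ≡⟨ rearrange S₁ (cells L′) z S₂ ⟩
    squares L′ + (z * z + z + 2 * cells L′) ∎
    where
    open ≡-Reasoning
    z = firstColumn L
    L′ = map pred L
    S₁ = ∑[ a ∈ L′ ] (a * a)
    S₂ = ∑[ a ∈ L′ ] ∑[ b ∈ L′ ] (a ⊓ b)
    rowPart : ∑[ a ∈ L ] (pred a * pred a + 2 * pred a + 1 ⊓ a) ≡ S₁ + 2 * cells L′ + z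
    rowPart = begin
      ∑[ a ∈ L ] (pred a * pred a + 2 * pred a + 1 ⊓ a)
        ≡⟨ trans (∑-distrib-+ L _ (1 ⊓_)) (cong (_+ z) (∑-distrib-+ L (λ a → pred a * pred a) (λ a → 2 * pred a))) ⟩
      ∑[ a ∈ L ] (pred a * pred a) + ∑[ a ∈ L ] (2 * pred a) + z
        ≡⟨ cong (_+ z) (cong₂ _+_ (sym (∑-map pred L (λ a → a * a)))
             (trans (sym (*-distribˡ-∑ 2 L pred)) (cong (2 *_) (sym (∑-map pred L (λ a → a)))))) ⟩
      S₁ + 2 * cells L′ + z ∎
    columnPart : ∑[ a ∈ L ] ∑[ b ∈ L ] (pred a ⊓ pred b + (1 ⊓ a) * (1 ⊓ b)) ≡ S₂ + z * z
    columnPart = begin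
      ∑[ a ∈ L ] ∑[ b ∈ L ] (pred a ⊓ pred b + (1 ⊓ a) * (1 ⊓ b))
        ≡⟨ trans (∑-cong L (λ a → ∑-distrib-+ L (λ b → pred a ⊓ pred b) (λ b → (1 ⊓ a) * (1 ⊓ b))))
                 (∑-distrib-+ L _ _) ⟩
      ∑[ a ∈ L ] ∑[ b ∈ L ] (pred a ⊓ pred b) + ∑[ a ∈ L ] ∑[ b ∈ L ] ((1 ⊓ a) * (1 ⊓ b))
        ≡⟨ cong₂ _+_ (sym (trans (∑-map pred L _) (∑-cong L (λ a → ∑-map pred L (pred a ⊓_)))))
                     (sym (∑*∑ L L (1 ⊓_) (1 ⊓_))) ⟩
      S₂ + z * z ∎
    rearrange : ∀ s₁ c z s₂ → (s₁ + 2 * c + z) + (s₂ + z * z) ≡ (s₁ + s₂) + (z * z + z + 2 * c)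
    rearrange = solve-∀

  firstColumn-removeColumn : ∀ L → firstColumn (map pred L) ≤ firstColumn L
  firstColumn-removeColumn L = subst (_≤ firstColumn L) (sym (∑-map pred L (1 ⊓_))) (∑-mono L col)
    where
    ∑-mono : ∀ L {f g : ℕ → ℕ} → (∀ a → f a ≤ g a) → ∑ L f ≤ ∑ L g
    ∑-mono []      f≤g = z≤n
    ∑-mono (a ∷ L) f≤g = +-mono-≤ (f≤g a) (∑-mono L f≤g)
    col : ∀ a → 1 ⊓ pred a ≤ 1 ⊓ a
    col zero          = z≤n
    col (suc zero)    = z≤n
    col (suc (suc a)) = ≤-refl

  GreedyBound-removeRow : ∀ {K} m rest → All (_≤ m) rest → 1 ≤ m → firstColumn (m ∷ rest) ≤ m → m ≤ K →
                          GreedyBound m (cells rest) (squares rest) → GreedyBound K (cells (m ∷ rest)) (squares (m ∷ rest))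
  GreedyBound-removeRow m rest rest≤m 1≤m col≤m m≤K b =
    GreedyBound-mono m≤K (subst (GreedyBound m _) (sym (squares-removeRow m rest rest≤m))
      (GreedyBound-addRow 1≤m (≤-trans (cells≤firstColumn* (m ∷ rest) (≤-refl ∷ rest≤m)) (*-monoˡ-≤ m col≤m)) b))

  GreedyBound-removeColumn : ∀ {K m} L → All (_≤ m) L → m < firstColumn L → firstColumn L ≤ K →
                             GreedyBound (firstColumn L) (cells (map pred L)) (squares (map pred L)) →
                             GreedyBound K (cells L) (squares L)
  GreedyBound-removeColumn {m = m} L L≤m m<z z≤K b =
    GreedyBound-mono z≤K (subst₂ (GreedyBound z) (sym (cells-removeColumn L)) (sym (squares-removeColumn L))
      (GreedyBound-addRow (≤-trans (s≤s z≤n) m<z)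
        (subst (_≤ z * z) (cells-removeColumn L) (≤-trans (cells≤firstColumn* L L≤m) (*-monoʳ-≤ z (<⇒≤ m<z)))) b))
    where
    z = firstColumn L

  -- Inside a K × K box, squares is largest when the cells are packed greedily into full rows:
  -- peel off a longest row or, if the first column is longer, the first column, and recurse.
  squares≤greedy : ∀ {K} L → 1 ≤ K → firstColumn L ≤ K → All (_≤ K) L → GreedyBound K (cells L) (squares L)
  squares≤greedy rows = go rows (<-wellFounded (cells rows))
    where
    go : ∀ {K} L → Acc _<_ (cells L) → 1 ≤ K → firstColumn L ≤ K → All (_≤ K) L →
         GreedyBound K (cells L) (squares L)
    go         []      _              1≤K _     _   = greedy 0 0 1≤K z≤n refl z≤n
    go {K} (a ∷ L) (acc smaller) 1≤K col≤K L≤K with extractMax a L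
    ... | zero , rest , p , rest≤0 with empty-rows (0 ∷ rest) (z≤n ∷ rest≤0)
    ...   | cells≡0 , squares≡0 =
      subst₂ (GreedyBound _) (sym (trans (cells-↭ p) cells≡0)) (sym (trans (squares-↭ p) squares≡0))
             (greedy 0 0 1≤K z≤n refl z≤n)
    go {K} (a ∷ L) (acc smaller) 1≤K col≤K L≤K | m@(suc _) , rest , p , rest≤m
      with firstColumn (m ∷ rest) ≤? m | All-resp-↭ p L≤K
    ... | yes col≤m | m≤K ∷ _ =
      subst₂ (GreedyBound _) (sym (cells-↭ p)) (sym (squares-↭ p))
        (GreedyBound-removeRow m rest rest≤m (s≤s z≤n) col≤m m≤K
          (go rest (smaller (subst (cells rest <_) (sym (cells-↭ p)) (m<n+m (cells rest) (s≤s z≤n))))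
              (s≤s z≤n) (≤-trans (n≤1+n _) col≤m) rest≤m))
    ... | no col≰m | _ =
      subst₂ (GreedyBound _) (sym (cells-↭ p)) (sym (squares-↭ p))
        (GreedyBound-removeColumn (m ∷ rest) (≤-refl ∷ rest≤m) (≰⇒> col≰m) (subst (_≤ K) (firstColumn-↭ p) col≤K)
          (go (map pred (m ∷ rest))
              (smaller (subst (cells (map pred (m ∷ rest)) <_) (sym (trans (cells-↭ p) (cells-removeColumn (m ∷ rest))))
                              (m<n+m _ (1≤z col≰m))))
              (1≤z col≰m) (firstColumn-removeColumn (m ∷ rest)) (shortened col≰m)))
      where
      1≤z : ¬ firstColumn (m ∷ rest) ≤ m → 1 ≤ firstColumn (m ∷ rest)
      1≤z col≰m = ≤-trans (s≤s z≤n) (≰⇒> col≰m)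
      shortened : ¬ firstColumn (m ∷ rest) ≤ m → All (_≤ firstColumn (m ∷ rest)) (map pred (m ∷ rest))
      shortened col≰m = All.map⁺ (All.map (λ a≤m → ≤-trans (pred-mono-≤ a≤m) (≤-trans (n≤1+n _) (<⇒≤ (≰⇒> col≰m))))
                                          (≤-refl ∷ rest≤m))

module ThresholdValues where

  open import Data.Fin using (Fin)
  open import Data.Integer using (ℤ; +_; 0ℤ; 1ℤ; _+_; _*_; _-_; _≤_; _<_; _⊓_)
  open import Data.Integer.Properties
    using (_<?_; <-≤-trans; ≮⇒≥; +-mono-<; +-mono-≤; +-monoˡ-≤; +-monoʳ-≤; ≤-total; drop‿+≤+; mono-≤-distrib-⊓;
           pos-*; +-comm; +-assoc; *-identityʳ; <-irrefl; i≤j⇒i⊓j≡i; i≥j⇒i⊓j≡j; +-injective)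
  open import Data.Integer.Tactic.RingSolver using (solve-∀)
  open import Data.List using (List; []; _∷_; map; filter; length; allFin)
  open import Data.List.Properties using (length-map; length-filter)
  open import Data.List.Relation.Unary.All as All using (All; []; _∷_)
  open import Data.List.Relation.Unary.All.Properties using (all-filter; map⁺)
  open import Data.Nat as ℕ using (ℕ)
  import Data.Nat.Properties as ℕ
  open import Data.Empty using (⊥-elim)
  open import Data.Sum using (inj₁; inj₂)
  open import Relation.Nullary using (yes; no; ¬_)
  open import Relation.Unary.Properties using (∁?)
  open import Relation.Binary.PropositionalEquality using (_≡_; refl; sym; trans; cong; cong₂; subst₂; module ≡-Reasoning)

  open Variance
  open DegreeSums using (𝟙; length-filter≡∑; ∑-punctured)
  open ThresholdGraphs using (θ; θ-mono; θ-⊓; θ-double; thresholdDeg)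
  open FerrersDiagrams using (cells; squares)
  module ℕ∑ = FiniteSums ℕ.+-*-commutativeSemiring

  -- The degree of a vertex of value y in the threshold graph on the values xs, which include y
  -- itself: its own term θ (y + y) = θ y is removed.
  thresholdDegOf : List ℤ → ℤ → ℤ
  thresholdDegOf xs y = ∑[ z ∈ xs ] θ (y + z) - θ y

  σ-thresholdDeg≡ : ∀ {n} (x : Fin n → ℤ) →
                    σ (allFin n) (thresholdDeg x) ≡ σ (map x (allFin n)) (thresholdDegOf (map x (allFin n)))
  σ-thresholdDeg≡ {n} x = trans (cong₂ (λ s t → + length (allFin n) * s - t * t)
                                    (∑-cong (allFin n) (λ u → cong₂ _*_ (deg≡ u) (deg≡ u))) (∑-cong (allFin n) deg≡))
                                (sym (σ-map x (allFin n) (thresholdDegOf xs)))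
    where
    xs = map x (allFin n)
    deg≡ : ∀ u → thresholdDeg x u ≡ thresholdDegOf xs (x u)
    deg≡ u = trans (∑-punctured u (λ v → θ (x u + x v)))
                   (cong₂ _-_ (sym (∑-map x (allFin n) (λ z → θ (x u + z)))) (θ-double (x u)))

  +∑ : ∀ {a} {A : Set a} (L : List A) (f : A → ℕ) → + ℕ∑.∑ L f ≡ ∑[ x ∈ L ] (+ f x)
  +∑ []      f = refl
  +∑ (x ∷ L) f = cong (_+_ (+ f x)) (+∑ L f)

  -- σ of the degrees of a threshold graph on N vertices whose C positive vertices form a clique and
  -- whose other edges form a Ferrers diagram with R cells and squares Q: a clique vertex has degree
  -- C − 1 plus its row length, any other vertex its column length.
  σ-threshold : ℤ → ℤ → ℤ → ℤ → ℤ
  σ-threshold N C R Q = N * (C * ((C - 1ℤ) * (C - 1ℤ)) + + 2 * (C - 1ℤ) * R + Q)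
                        - (C * (C - 1ℤ) + + 2 * R) * (C * (C - 1ℤ) + + 2 * R)

  -- The positive values form a clique, the others an independent set, and the neighbourhoods
  -- of the independent vertices are nested.
  module Decomposition (xs : List ℤ) where

    Pos NonPos : List ℤ
    Pos    = filter (0ℤ <?_) xs
    NonPos = filter (∁? (0ℤ <?_)) xs

    Pos-positive : All (0ℤ <_) Pos
    Pos-positive = all-filter (0ℤ <?_) xs

    NonPos-nonpositive : All (λ z → ¬ 0ℤ < z) NonPos
    NonPos-nonpositive = all-filter (∁? (0ℤ <?_)) xs

    row : ℤ → ℕ
    row y = length (filter (λ z → 0ℤ <? y + z) NonPos)

    column : ℤ → ℤ
    column z = ∑[ y ∈ Pos ] θ (z + y)

    rows : List ℕ
    rows = map row Pos

    h : ℤ → ℤ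
    h = thresholdDegOf xs

    C : ℤ
    C = + length Pos

    +row : ∀ y → + row y ≡ ∑[ z ∈ NonPos ] θ (y + z)
    +row y = length-filter≡∑ (λ z → 0ℤ <? y + z) NonPos

    row-mono : ∀ {y y′} → y ≤ y′ → row y ℕ.≤ row y′
    row-mono {y} {y′} y≤y′ = drop‿+≤+ (subst₂ _≤_ (sym (+row y)) (sym (+row y′))
      (∑-mono-≤ NonPos (λ z → θ-mono (+-monoˡ-≤ z y≤y′))))

    row-⊓ : ∀ y y′ → row (y ⊓ y′) ≡ row y ℕ.⊓ row y′
    row-⊓ y y′ with ≤-total y y′
    ... | inj₁ y≤y′ = trans (cong row (i≤j⇒i⊓j≡i y≤y′)) (sym (ℕ.m≤n⇒m⊓n≡m (row-mono y≤y′)))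
    ... | inj₂ y′≤y = trans (cong row (i≥j⇒i⊓j≡j y′≤y)) (sym (ℕ.m≥n⇒m⊓n≡n (row-mono y′≤y)))

    θ-Pos : ∀ {y} → 0ℤ < y → ∑[ z ∈ Pos ] θ (y + z) ≡ C
    θ-Pos {y} 0<y = trans (∑-congᴬ (All.map one Pos-positive)) (trans (∑-const Pos 1ℤ) (*-identityʳ C))
      where
      one : ∀ {z} → 0ℤ < z → θ (y + z) ≡ 1ℤ
      one {z} 0<z with 0ℤ <? y + z
      ... | yes _    = refl
      ... | no  0≮s = ⊥-elim (0≮s (+-mono-< 0<y 0<z))

    θ-NonPos : ∀ {y} → ¬ 0ℤ < y → ∑[ z ∈ NonPos ] θ (y + z) ≡ 0ℤ
    θ-NonPos {y} 0≮y = trans (∑-congᴬ (All.map zero′ NonPos-nonpositive)) (∑-zero NonPos)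
      where
      zero′ : ∀ {z} → ¬ 0ℤ < z → θ (y + z) ≡ 0ℤ
      zero′ {z} 0≮z with 0ℤ <? y + z
      ... | yes 0<s = ⊥-elim (<-irrefl refl (<-≤-trans 0<s (+-mono-≤ (≮⇒≥ 0≮y) (≮⇒≥ 0≮z))))
      ... | no  _   = refl

    ∑-split : ∀ y → ∑[ z ∈ xs ] θ (y + z) ≡ ∑[ z ∈ Pos ] θ (y + z) + ∑[ z ∈ NonPos ] θ (y + z)
    ∑-split y = ∑-filter (0ℤ <?_) xs (λ z → θ (y + z))

    h-Pos : ∀ {y} → 0ℤ < y → h y ≡ (C - 1ℤ) + + row y
    h-Pos {y} 0<y = begin
      ∑[ z ∈ xs ] θ (y + z) - θ y   ≡⟨ cong₂ _-_ (trans (∑-split y) (cong₂ _+_ (θ-Pos 0<y) (sym (+row y)))) (θ-pos 0<y) ⟩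
      C + + row y - 1ℤ               ≡⟨ lemma C (+ row y) ⟩
      (C - 1ℤ) + + row y             ∎
      where
      open ≡-Reasoning
      lemma : ∀ a b → a + b - 1ℤ ≡ (a - 1ℤ) + b
      lemma = solve-∀
      θ-pos : ∀ {y} → 0ℤ < y → θ y ≡ 1ℤ
      θ-pos {y} 0<y with 0ℤ <? y
      ... | yes _   = refl
      ... | no  0≮y = ⊥-elim (0≮y 0<y)

    h-NonPos : ∀ {z} → ¬ 0ℤ < z → h z ≡ column z
    h-NonPos {z} 0≮z = begin
      ∑[ w ∈ xs ] θ (z + w) - θ z
        ≡⟨ cong₂ _-_ (trans (∑-split z) (cong (_+_ (column z)) (θ-NonPos 0≮z))) (θ-nonpos 0≮z) ⟩
      column z + 0ℤ - 0ℤ             ≡⟨ lemma (column z) ⟩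
      column z                       ∎
      where
      open ≡-Reasoning
      lemma : ∀ a → a + 0ℤ - 0ℤ ≡ a
      lemma = solve-∀
      θ-nonpos : ∀ {y} → ¬ 0ℤ < y → θ y ≡ 0ℤ
      θ-nonpos {y} 0≮y with 0ℤ <? y
      ... | yes 0<y = ⊥-elim (0≮y 0<y)
      ... | no  _   = refl

    R : ℤ
    R = ∑[ y ∈ Pos ] (+ row y)

    cells-rows : + cells rows ≡ R
    cells-rows = trans (cong +_ (ℕ∑.∑-map row Pos (λ a → a))) (+∑ Pos row)

    ∑-column : ∑ NonPos column ≡ R
    ∑-column = trans (∑-comm NonPos Pos (λ z y → θ (z + y)))
                     (∑-cong Pos (λ y → trans (∑-cong NonPos (λ z → cong θ (+-comm z y))) (sym (+row y))))

    -- Two positive vertices y, y′ share exactly the independent neighbours of y ⊓ y′.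
    ∑-column² : ∑[ z ∈ NonPos ] (column z * column z) ≡ ∑[ y ∈ Pos ] ∑[ y′ ∈ Pos ] (+ (row y ℕ.⊓ row y′))
    ∑-column² = begin
      ∑[ z ∈ NonPos ] (column z * column z)
        ≡⟨ ∑-cong NonPos (λ z → ∑*∑ Pos Pos (λ y → θ (z + y)) (λ y′ → θ (z + y′))) ⟩
      ∑[ z ∈ NonPos ] ∑[ y ∈ Pos ] ∑[ y′ ∈ Pos ] (θ (z + y) * θ (z + y′))
        ≡⟨ trans (∑-comm NonPos Pos _) (∑-cong Pos (λ y → ∑-comm NonPos Pos _)) ⟩
      ∑[ y ∈ Pos ] ∑[ y′ ∈ Pos ] ∑[ z ∈ NonPos ] (θ (z + y) * θ (z + y′))
        ≡⟨ ∑-cong Pos (λ y → ∑-cong Pos (λ y′ → common y y′)) ⟩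
      ∑[ y ∈ Pos ] ∑[ y′ ∈ Pos ] (+ (row y ℕ.⊓ row y′)) ∎
      where
      open ≡-Reasoning
      common : ∀ y y′ → ∑[ z ∈ NonPos ] (θ (z + y) * θ (z + y′)) ≡ + (row y ℕ.⊓ row y′)
      common y y′ = begin
        ∑[ z ∈ NonPos ] (θ (z + y) * θ (z + y′))
          ≡⟨ ∑-cong NonPos (λ z → trans (sym (θ-⊓ (z + y) (z + y′)))
               (cong θ (trans (sym (mono-≤-distrib-⊓ (+-monoʳ-≤ z) y y′)) (+-comm z (y ⊓ y′))))) ⟩
        ∑[ z ∈ NonPos ] θ (y ⊓ y′ + z)   ≡⟨ +row (y ⊓ y′) ⟨
        + row (y ⊓ y′)                   ≡⟨ cong +_ (row-⊓ y y′) ⟩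
        + (row y ℕ.⊓ row y′)            ∎

    Q : ℤ
    Q = ∑[ y ∈ Pos ] (+ row y * + row y) + ∑[ z ∈ NonPos ] (column z * column z)

    squares-rows : + squares rows ≡ Q
    squares-rows = begin
      + ℕ∑.∑ rows (λ a → a ℕ.* a) + + ℕ∑.∑ rows (λ a → ℕ∑.∑ rows (a ℕ.⊓_))
        ≡⟨ cong₂ _+_ (trans (cong +_ (ℕ∑.∑-map row Pos _)) (trans (+∑ Pos _) (∑-cong Pos (λ y → pos-* (row y) (row y)))))
                     (trans (cong +_ (trans (ℕ∑.∑-map row Pos _) (ℕ∑.∑-cong Pos (λ y → ℕ∑.∑-map row Pos (row y ℕ.⊓_)))))
                       (trans (+∑ Pos _) (∑-cong Pos (λ y → +∑ Pos (λ y′ → row y ℕ.⊓ row y′))))) ⟩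
      ∑[ y ∈ Pos ] (+ row y * + row y) + ∑[ y ∈ Pos ] ∑[ y′ ∈ Pos ] (+ (row y ℕ.⊓ row y′))
        ≡⟨ cong (_+_ (∑[ y ∈ Pos ] (+ row y * + row y))) (sym ∑-column²) ⟩
      Q ∎
      where open ≡-Reasoning

    ∑h : ∑ xs h ≡ C * (C - 1ℤ) + + 2 * R
    ∑h = begin
      ∑ xs h                                              ≡⟨ ∑-filter (0ℤ <?_) xs h ⟩
      ∑ Pos h + ∑ NonPos h
        ≡⟨ cong₂ _+_ (∑-congᴬ (All.map h-Pos Pos-positive)) (∑-congᴬ (All.map h-NonPos NonPos-nonpositive)) ⟩
      ∑[ y ∈ Pos ] ((C - 1ℤ) + + row y) + ∑ NonPos column
        ≡⟨ cong₂ _+_ (trans (∑-distrib-+ Pos _ _) (cong (_+ R) (∑-const Pos (C - 1ℤ)))) ∑-column ⟩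
      (C * (C - 1ℤ) + R) + R                              ≡⟨ lemma (C * (C - 1ℤ)) R ⟩
      C * (C - 1ℤ) + + 2 * R                              ∎
      where
      open ≡-Reasoning
      lemma : ∀ a b → a + b + b ≡ a + + 2 * b
      lemma = solve-∀

    ∑h² : ∑[ y ∈ xs ] (h y * h y) ≡ C * ((C - 1ℤ) * (C - 1ℤ)) + + 2 * (C - 1ℤ) * R + Q
    ∑h² = begin
      ∑[ y ∈ xs ] (h y * h y)                              ≡⟨ ∑-filter (0ℤ <?_) xs _ ⟩
      ∑[ y ∈ Pos ] (h y * h y) + ∑[ z ∈ NonPos ] (h z * h z)
        ≡⟨ cong₂ _+_ (∑-congᴬ (All.map (λ p → cong₂ _*_ (h-Pos p) (h-Pos p)) Pos-positive))
                     (∑-congᴬ (All.map (λ p → cong₂ _*_ (h-NonPos p) (h-NonPos p)) NonPos-nonpositive)) ⟩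
      ∑[ y ∈ Pos ] (((C - 1ℤ) + + row y) * ((C - 1ℤ) + + row y)) + ∑[ z ∈ NonPos ] (column z * column z)
        ≡⟨ cong (_+ ∑[ z ∈ NonPos ] (column z * column z)) rowPart ⟩
      (C * ((C - 1ℤ) * (C - 1ℤ)) + + 2 * (C - 1ℤ) * R + ∑[ y ∈ Pos ] (+ row y * + row y)) + ∑[ z ∈ NonPos ] (column z * column z)
        ≡⟨ +-assoc (C * ((C - 1ℤ) * (C - 1ℤ)) + + 2 * (C - 1ℤ) * R) _ _ ⟩
      C * ((C - 1ℤ) * (C - 1ℤ)) + + 2 * (C - 1ℤ) * R + Q ∎
      where
      open ≡-Reasoning
      expand : ∀ a b → (a + b) * (a + b) ≡ a * a + + 2 * a * b + b * b
      expand = solve-∀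
      rowPart : ∑[ y ∈ Pos ] (((C - 1ℤ) + + row y) * ((C - 1ℤ) + + row y))
                ≡ C * ((C - 1ℤ) * (C - 1ℤ)) + + 2 * (C - 1ℤ) * R + ∑[ y ∈ Pos ] (+ row y * + row y)
      rowPart = trans (∑-cong Pos (λ y → expand (C - 1ℤ) (+ row y)))
        (trans (∑-distrib-+ Pos _ _) (cong (_+ ∑[ y ∈ Pos ] (+ row y * + row y))
          (trans (∑-distrib-+ Pos _ _) (cong₂ _+_ (∑-const Pos _) (sym (*-distribˡ-∑ (+ 2 * (C - 1ℤ)) Pos (λ y → + row y)))))))

    σ-h : σ xs h ≡ σ-threshold (+ length xs) C (+ cells rows) (+ squares rows)
    σ-h = trans (cong₂ (λ s t → + length xs * s - t * t) ∑h² ∑h)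
                (cong₂ (σ-threshold (+ length xs) C) (sym cells-rows) (sym squares-rows))

    length-Pos+NonPos : length Pos ℕ.+ length NonPos ≡ length xs
    length-Pos+NonPos = +-injective (begin
      + length Pos + + length NonPos                   ≡⟨ cong₂ _+_ (count Pos) (count NonPos) ⟩
      ∑[ _ ∈ Pos ] 1ℤ + ∑[ _ ∈ NonPos ] 1ℤ            ≡⟨ ∑-filter (0ℤ <?_) xs (λ _ → 1ℤ) ⟨
      ∑[ _ ∈ xs ] 1ℤ                                  ≡⟨ count xs ⟨
      + length xs                                      ∎)
      where
      open ≡-Reasoning
      count : ∀ (ys : List ℤ) → + length ys ≡ ∑[ _ ∈ ys ] 1ℤ
      count ys = sym (trans (∑-const ys 1ℤ) (*-identityʳ (+ length ys)))

    length-rows : length rows ≡ length Pos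
    length-rows = length-map row Pos

    rows≤ : All (ℕ._≤ length NonPos) rows
    rows≤ = map⁺ (All.tabulate (λ {y} _ → length-filter (λ z → 0ℤ <? y + z) NonPos))

module ThreeDegreeClasses where

  open import Data.Integer using (ℤ; +_; 0ℤ; 1ℤ; _+_; _*_; _-_; _≤_)
  open import Data.Integer.Properties
    using (≤-trans; +-mono-≤; pos-*)
  open import Data.Integer.Tactic.RingSolver using (solve-∀)
  open import Data.Nat.Tactic.RingSolver using () renaming (solve-∀ to ℕsolve-∀)
  open import Data.Nat as ℕ using (ℕ; zero; suc; _∸_; _^_)
  import Data.Nat.Properties as ℕ
  open import Relation.Nullary using (yes; no)
  open import Relation.Binary.PropositionalEquality using (_≡_; refl; sym; trans; cong; cong₂; subst; module ≡-Reasoning)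
  open import Data.Product using (_,_)

  open Variance using (0≤+; 0≤*; ≤-of-nonneg-+)

  sigmaSplit : ℕ → ℕ → ℕ
  sigmaSplit a b = a ℕ.* b ℕ.* (b ∸ 1) ^ 2

  σ-split : ℤ → ℤ → ℤ
  σ-split a b = a * b * ((b - 1ℤ) * (b - 1ℤ))

  +sigmaSplit : ∀ a b → + sigmaSplit a b ≡ σ-split (+ a) (+ b)
  +sigmaSplit a zero    = trans (cong +_ (ℕ.*-zeroʳ (a ℕ.* 0))) (sym (lemma (+ a)))
    where
    lemma : ∀ a → a * 0ℤ * ((0ℤ - 1ℤ) * (0ℤ - 1ℤ)) ≡ 0ℤ
    lemma = solve-∀
  +sigmaSplit a (suc b) = begin
    + (a ℕ.* suc b ℕ.* (b ℕ.* (b ℕ.* 1)))    ≡⟨ pos-* (a ℕ.* suc b) _ ⟩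
    + (a ℕ.* suc b) * + (b ℕ.* (b ℕ.* 1))    ≡⟨ cong₂ _*_ (pos-* a (suc b)) (trans (pos-* b _) (cong (+ b *_) (pos-* b 1))) ⟩
    + a * (1ℤ + + b) * (+ b * (+ b * 1ℤ))    ≡⟨ lemma (+ a) (+ b) ⟩
    σ-split (+ a) (+ suc b)                  ∎
    where
    open ≡-Reasoning
    lemma : ∀ a b → a * (1ℤ + b) * (b * (b * 1ℤ)) ≡ a * (1ℤ + b) * (((1ℤ + b) - 1ℤ) * ((1ℤ + b) - 1ℤ))
    lemma = solve-∀

  SplitBound : ℕ → ℤ → Set
  SplitBound N B = ∀ a b → a ℕ.+ b ≡ N → σ-split (+ a) (+ b) ≤ B

  -- σ_t of the threshold graph with p vertices of degree p + q + r − 1, q further clique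
  -- vertices of degree p + q − 1, and r vertices of degree p.
  σ₃ : ℤ → ℤ → ℤ → ℤ
  σ₃ p q r = r * (p * ((q + r - 1ℤ) * (q + r - 1ℤ) + q * r) + q * ((q - 1ℤ) * (q - 1ℤ)))

  σ₃-zero : ∀ p r → σ₃ p 0ℤ r ≡ σ-split p r
  σ₃-zero = identity
    where
    identity : ∀ p r → r * (p * ((0ℤ + r - 1ℤ) * (0ℤ + r - 1ℤ) + 0ℤ * r) + 0ℤ * ((0ℤ - 1ℤ) * (0ℤ - 1ℤ)))
                       ≡ p * r * ((r - 1ℤ) * (r - 1ℤ))
    identity = solve-∀

  -- Moving the q middle vertices into the independent set, when q ≤ 2p + 1.
  σ₃≤σ-split : ∀ {p q r d} → 0ℤ ≤ p → 0ℤ ≤ q → 0ℤ ≤ r → 0ℤ ≤ d → + 2 * p ≡ q + d →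
               σ₃ p (1ℤ + q) r ≤ σ-split p (1ℤ + q + r)
  σ₃≤σ-split {p} {q} {r} {d} 0≤p 0≤q 0≤r 0≤d 2p≡q+d =
    ≤-of-nonneg-+ ((1ℤ + q) * q * (p * q + r * d))
         (0≤* (0≤* (+-mono-≤ (0≤+ 1) 0≤q) 0≤q) (+-mono-≤ (0≤* 0≤p 0≤q) (0≤* 0≤r 0≤d)))
         (trans (identity p q r) (cong (λ s → σ₃ p (1ℤ + q) r + (1ℤ + q) * q * (p * q + r * s))
                                       (trans (cong (_- q) 2p≡q+d) (cancel q d))))
    where
    identity : ∀ p q r → let q₁ = 1ℤ + q in
               p * (q₁ + r) * ((q₁ + r - 1ℤ) * (q₁ + r - 1ℤ))
               ≡ r * (p * ((q₁ + r - 1ℤ) * (q₁ + r - 1ℤ) + q₁ * r) + q₁ * ((q₁ - 1ℤ) * (q₁ - 1ℤ)))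
                 + q₁ * q * (p * q + r * (+ 2 * p - q))
    identity = solve-∀
    cancel : ∀ q d → q + d - q ≡ d
    cancel = solve-∀

  -- Promoting one middle vertex to a dominating one, when q ≥ 2p + 2 and p + q ≤ r.
  σ₃-shift : ∀ {p e t} → 0ℤ ≤ p → 0ℤ ≤ e → 0ℤ ≤ t → let q = + 2 * p + + 2 + e ; r = p + q + t in
             σ₃ p q r ≤ σ₃ (1ℤ + p) (q - 1ℤ) r
  σ₃-shift {p} {e} {t} 0≤p 0≤e 0≤t = ≤-of-nonneg-+ (r * s) (0≤* 0≤r 0≤s) (identity p e t)
    where
    q = + 2 * p + + 2 + e
    r = p + q + t
    s = + 6 * (p * p) + + 8 * (p * e) + + 9 * (p * t) + + 10 * p + + 2 * (e * e) + + 5 * (e * t) + + 6 * e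
        + t * t + + 5 * t + + 4
    0≤r : 0ℤ ≤ r
    0≤r = +-mono-≤ (+-mono-≤ 0≤p (+-mono-≤ (+-mono-≤ (0≤* (0≤+ 2) 0≤p) (0≤+ 2)) 0≤e)) 0≤t
    0≤s : 0ℤ ≤ s
    0≤s = +-mono-≤ (+-mono-≤ (+-mono-≤ (+-mono-≤ (+-mono-≤ (+-mono-≤ (+-mono-≤ (+-mono-≤ (+-mono-≤
            (0≤* (0≤+ 6) (0≤* 0≤p 0≤p)) (0≤* (0≤+ 8) (0≤* 0≤p 0≤e))) (0≤* (0≤+ 9) (0≤* 0≤p 0≤t)))
            (0≤* (0≤+ 10) 0≤p)) (0≤* (0≤+ 2) (0≤* 0≤e 0≤e))) (0≤* (0≤+ 5) (0≤* 0≤e 0≤t)))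
            (0≤* (0≤+ 6) 0≤e)) (0≤* 0≤t 0≤t)) (0≤* (0≤+ 5) 0≤t)) (0≤+ 4)
    identity : ∀ p e t → let q = + 2 * p + + 2 + e ; r = p + q + t ; q′ = q - 1ℤ ; p′ = 1ℤ + p in
               r * (p′ * ((q′ + r - 1ℤ) * (q′ + r - 1ℤ) + q′ * r) + q′ * ((q′ - 1ℤ) * (q′ - 1ℤ)))
               ≡ r * (p * ((q + r - 1ℤ) * (q + r - 1ℤ) + q * r) + q * ((q - 1ℤ) * (q - 1ℤ)))
                 + r * (+ 6 * (p * p) + + 8 * (p * e) + + 9 * (p * t) + + 10 * p + + 2 * (e * e) + + 5 * (e * t)
                        + + 6 * e + t * t + + 5 * t + + 4)
    identity = solve-∀

  σ₃≤ : ∀ {B} q p r → p ℕ.+ q ℕ.≤ r → SplitBound (p ℕ.+ q ℕ.+ r) B → σ₃ (+ p) (+ q) (+ r) ≤ B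
  σ₃≤ zero p r _ bound = subst (_≤ _) (sym (σ₃-zero (+ p) (+ r))) (bound p r (cong (ℕ._+ r) (sym (ℕ.+-identityʳ p))))
  σ₃≤ (suc q) p r p+q≤r bound with q ℕ.≤? 2 ℕ.* p
  ... | yes q≤2p with ℕ.m≤n⇒∃[o]m+o≡n q≤2p
  ...   | d , q+d≡2p = ≤-trans (σ₃≤σ-split (0≤+ p) (0≤+ q) (0≤+ r) (0≤+ d) (trans (sym (pos-* 2 p)) (cong +_ (sym q+d≡2p))))
                                (bound p (suc q ℕ.+ r) (sym (ℕ.+-assoc p (suc q) r)))
  σ₃≤ (suc q) p r p+q≤r bound | no q≰2p with ℕ.m≤n⇒∃[o]m+o≡n (ℕ.≰⇒> q≰2p) | ℕ.m≤n⇒∃[o]m+o≡n p+q≤r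
  ... | e , refl | t , refl = ≤-trans shift (σ₃≤ q (suc p) r (subst (ℕ._≤ r) (ℕ.+-suc p q) p+q≤r) bound′)
    where
    bound′ : SplitBound (suc p ℕ.+ q ℕ.+ r) _
    bound′ a b eq = bound a b (trans eq (cong (ℕ._+ r) (sym (ℕ.+-suc p q))))
    Q≡ : + suc q ≡ + 2 * + p + + 2 + + e
    Q≡ = trans (cong +_ (reorder (2 ℕ.* p) e)) (cong (λ x → x + + 2 + + e) (pos-* 2 p))
      where
      reorder : ∀ x e → 2 ℕ.+ (x ℕ.+ e) ≡ x ℕ.+ 2 ℕ.+ e
      reorder = ℕsolve-∀
    shift : σ₃ (+ p) (+ suc q) (+ r) ≤ σ₃ (+ suc p) (+ q) (+ r)
    shift = subst (λ Q → σ₃ (+ p) Q (+ p + Q + + t) ≤ σ₃ (1ℤ + + p) (Q - 1ℤ) (+ p + Q + + t)) (sym Q≡)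
                  (σ₃-shift (0≤+ p) (0≤+ e) (0≤+ t))

module GreedyPacking where

  open import Data.Integer using (ℤ; +_; 0ℤ; 1ℤ; _+_; _*_; _-_; _≤_; +≤+; -≤+)
  open import Data.Integer.Properties
    using (≤-refl; ≤-trans; +-mono-≤; pos-*; *-monoˡ-≤-nonNeg; *-cancelˡ-≤-pos; i≤j⇒0≤j-i; module ≤-Reasoning)
  open import Data.Integer.Tactic.RingSolver using (solve-∀)
  open import Data.Nat as ℕ using (zero; suc; z≤n; s≤s)
  import Data.Nat.Properties as ℕ
  open import Data.Product using (_×_; _,_)
  open import Relation.Nullary using (yes; no)
  open import Relation.Binary.PropositionalEquality using (_≡_; refl; sym; trans; cong; cong₂; subst; module ≡-Reasoning)

  open FerrersDiagrams using (greedySquares)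
  open ThresholdValues using (σ-threshold)
  open ThreeDegreeClasses
  open Variance using (0≤+; 0≤*; ≤-of-nonneg-+)

  σ-greedy : ℤ → ℤ → ℤ → ℤ → ℤ → ℤ
  σ-greedy N C K α ρ = σ-threshold N C (α * K + ρ) (α * K * K + α * α * K + ρ * ρ + (+ 2 * α + 1ℤ) * ρ)

  σ-threshold-greedy : ∀ N C K α ρ →
    σ-threshold (+ N) (+ C) (+ (α ℕ.* K ℕ.+ ρ)) (+ greedySquares K α ρ) ≡ σ-greedy (+ N) (+ C) (+ K) (+ α) (+ ρ)
  σ-threshold-greedy N C K α ρ = cong₂ (σ-threshold (+ N) (+ C)) (cong (_+ + ρ) (pos-* α K)) squares≡
    where
    open ≡-Reasoning
    squares≡ : + greedySquares K α ρ ≡ + α * + K * + K + + α * + α * + K + + ρ * + ρ + (+ 2 * + α + 1ℤ) * + ρ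
    squares≡ = begin
      + (α ℕ.* K ℕ.* K ℕ.+ α ℕ.* α ℕ.* K ℕ.+ ρ ℕ.* ρ ℕ.+ (2 ℕ.* α ℕ.+ 1) ℕ.* ρ)
        ≡⟨ cong₂ (λ x y → x + y) (cong₂ (λ x y → x + y) (cong₂ _+_ (trans (pos-* (α ℕ.* K) K) (cong (_* + K) (pos-* α K)))
                                                                    (trans (pos-* (α ℕ.* α) K) (cong (_* + K) (pos-* α α))))
                                                       (pos-* ρ ρ))
                                 (trans (pos-* (2 ℕ.* α ℕ.+ 1) ρ) (cong (λ x → (x + 1ℤ) * + ρ) (pos-* 2 α))) ⟩
      + α * + K * + K + + α * + α * + K + + ρ * + ρ + (+ 2 * + α + 1ℤ) * + ρ ∎

  -- Between two full packings, σ-greedy is linear in the partial row up to a term of the sign of N − 4.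
  σ-greedy-interpolation : ∀ N C α r t → let K = r + t in
    t * σ-greedy N C K α 0ℤ + r * σ-greedy N C K (1ℤ + α) 0ℤ ≡ K * σ-greedy N C K α r + (N - + 4) * (K * r * t)
  σ-greedy-interpolation = identity
    where
    identity : ∀ N C α r t → let K = r + t
                                 thr = λ R Q → N * (C * ((C - 1ℤ) * (C - 1ℤ)) + + 2 * (C - 1ℤ) * R + Q)
                                               - (C * (C - 1ℤ) + + 2 * R) * (C * (C - 1ℤ) + + 2 * R)
                                 grd = λ a ρ → thr (a * K + ρ) (a * K * K + a * a * K + ρ * ρ + (+ 2 * a + 1ℤ) * ρ)
                             in t * grd α 0ℤ + r * grd (1ℤ + α) 0ℤ ≡ K * grd α r + (N - + 4) * (K * r * t)
    identity = solve-∀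

  σ-greedy-fullRows : ∀ a q l → σ-greedy (a + q + l) (a + q) l a 0ℤ ≡ σ₃ a q l
  σ-greedy-fullRows = identity
    where
    identity : ∀ a q l → let N = a + q + l ; C = a + q ; R = a * l ; Q = a * l * l + a * a * l in
               N * (C * ((C - 1ℤ) * (C - 1ℤ)) + + 2 * (C - 1ℤ) * (R + 0ℤ) + (Q + 0ℤ * 0ℤ + (+ 2 * a + 1ℤ) * 0ℤ))
               - (C * (C - 1ℤ) + + 2 * (R + 0ℤ)) * (C * (C - 1ℤ) + + 2 * (R + 0ℤ))
               ≡ l * (a * ((q + l - 1ℤ) * (q + l - 1ℤ) + q * l) + q * ((q - 1ℤ) * (q - 1ℤ)))
    identity = solve-∀

  σ-greedy-fullColumns : ∀ c p a → σ-greedy (c + (p + a)) c c a 0ℤ ≡ σ₃ p a c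
  σ-greedy-fullColumns = identity
    where
    identity : ∀ c p a → let N = c + (p + a) ; R = a * c ; Q = a * c * c + a * a * c in
               N * (c * ((c - 1ℤ) * (c - 1ℤ)) + + 2 * (c - 1ℤ) * (R + 0ℤ) + (Q + 0ℤ * 0ℤ + (+ 2 * a + 1ℤ) * 0ℤ))
               - (c * (c - 1ℤ) + + 2 * (R + 0ℤ)) * (c * (c - 1ℤ) + + 2 * (R + 0ℤ))
               ≡ c * (p * ((a + c - 1ℤ) * (a + c - 1ℤ) + a * c) + a * ((a - 1ℤ) * (a - 1ℤ)))
    identity = solve-∀

  -- For N = 3 the interpolation term has the wrong sign; but then the only partial row is a single cell.
  three-vertices : ∀ m K α ρ → m ℕ.+ K ≡ 3 → 0 ℕ.< ρ → ρ ℕ.< K → α ℕ.* K ℕ.+ ρ ℕ.≤ m ℕ.* K →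
                   K ≡ 2 × α ≡ 0 × ρ ≡ 1
  three-vertices 0 .3 α (suc ρ) refl _ _ le with ℕ.≤-trans (ℕ.m≤n+m (suc ρ) (α ℕ.* 3)) le
  ... | ()
  three-vertices 1 .2 zero    1 refl _ _ _ = refl , refl , refl
  three-vertices 1 .2 (suc α) 1 refl _ _ le with ℕ.≤-trans (s≤s (s≤s (ℕ.m≤n+m 1 (α ℕ.* 2)))) le
  ... | s≤s (s≤s ())
  three-vertices 1 .2 α (suc (suc ρ)) refl _ (s≤s (s≤s ())) _
  three-vertices 2 .1 α (suc ρ) refl _ (s≤s ()) _
  three-vertices 3 .0 α ρ refl _ () _
  three-vertices (suc (suc (suc (suc m)))) K α ρ () _ _ _

  σ-greedy-three : ∀ c → c ℕ.≤ 3 → σ-greedy (+ 3) (+ c) (+ 2) 0ℤ 1ℤ ≤ σ-split 1ℤ (+ 2)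
  σ-greedy-three 0 _ = -≤+
  σ-greedy-three 1 _ = ≤-refl
  σ-greedy-three 2 _ = ≤-refl
  σ-greedy-three 3 _ = -≤+
  σ-greedy-three (suc (suc (suc (suc c)))) (s≤s (s≤s (s≤s ())))

  -- A greedy packing of at most m·K cells lies between two full packings with at most m rows,
  -- which the hypothesis bounds.
  σ-greedy≤ : ∀ {N B} c m K α ρ → 3 ℕ.≤ N → m ℕ.+ K ≡ N → c ℕ.≤ N → ρ ℕ.< K → α ℕ.* K ℕ.+ ρ ℕ.≤ m ℕ.* K →
              SplitBound N B → (∀ α′ → α′ ℕ.≤ m → σ-greedy (+ N) (+ c) (+ K) (+ α′) 0ℤ ≤ B) →
              σ-greedy (+ N) (+ c) (+ K) (+ α) (+ ρ) ≤ B
  σ-greedy≤ c m K α zero _ _ _ 0<K αK≤mK _ full =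
    full α (ℕ.*-cancelʳ-≤ α m K ⦃ ℕ.>-nonZero 0<K ⦄ (subst (ℕ._≤ m ℕ.* K) (ℕ.+-identityʳ _) αK≤mK))
  σ-greedy≤ {N} {B} c m K α (suc ρ) 3≤N m+K≡N c≤N ρ<K αK+ρ≤mK bound full with 4 ℕ.≤? N
  ... | no 4≰N with ℕ.≤-antisym (ℕ.≤-pred (ℕ.≰⇒> 4≰N)) 3≤N
  ...   | refl with three-vertices m K α (suc ρ) m+K≡N (s≤s z≤n) ρ<K αK+ρ≤mK
  ...     | refl , refl , refl = ≤-trans (σ-greedy-three c c≤N) (bound 1 2 refl)
  σ-greedy≤ {N} {B} c m K α (suc ρ) 3≤N m+K≡N c≤N ρ<K αK+ρ≤mK bound full | yes 4≤N
    with ℕ.m≤n⇒∃[o]m+o≡n (ℕ.<⇒≤ ρ<K)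
  ... | τ , refl = *-cancelˡ-≤-pos _ B (+ K) (begin
    + K * σ-greedy (+ N) (+ c) (+ K) (+ α) (+ r)
      ≤⟨ ≤-of-nonneg-+ ((+ N - + 4) * (+ K * + r * + τ))
           (0≤* (i≤j⇒0≤j-i (+≤+ 4≤N)) (0≤* (0≤* (0≤+ K) (0≤+ r)) (0≤+ τ))) refl ⟩
    + K * σ-greedy (+ N) (+ c) (+ K) (+ α) (+ r) + (+ N - + 4) * (+ K * + r * + τ)
      ≡⟨ σ-greedy-interpolation (+ N) (+ c) (+ α) (+ r) (+ τ) ⟨
    + τ * σ-greedy (+ N) (+ c) (+ K) (+ α) 0ℤ + + r * σ-greedy (+ N) (+ c) (+ K) (+ suc α) 0ℤ
      ≤⟨ +-mono-≤ (*-monoˡ-≤-nonNeg (+ τ) (full α (ℕ.<⇒≤ α<m))) (*-monoˡ-≤-nonNeg (+ r) (full (suc α) α<m)) ⟩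
    + τ * B + + r * B
      ≡⟨ lemma (+ τ) (+ r) B ⟩
    + K * B ∎)
    where
    open ≤-Reasoning
    r = suc ρ
    α<m : α ℕ.< m
    α<m = ℕ.*-cancelʳ-< K α m (ℕ.<-≤-trans (ℕ.m<m+n (α ℕ.* K) (s≤s z≤n)) αK+ρ≤mK)
    lemma : ∀ t r b → t * b + r * b ≡ (r + t) * b
    lemma = solve-∀

  σ-greedy-fullRows≤ : ∀ {N B} c l α → c ℕ.+ l ≡ N → c ℕ.≤ l → α ℕ.≤ c → SplitBound N B →
                       σ-greedy (+ N) (+ c) (+ l) (+ α) 0ℤ ≤ B
  σ-greedy-fullRows≤ {B = B} c l α refl c≤l α≤c bound with ℕ.m≤n⇒∃[o]m+o≡n α≤c
  ... | q , refl = subst (_≤ B) (sym (σ-greedy-fullRows (+ α) (+ q) (+ l))) (σ₃≤ q α l c≤l bound)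

  σ-greedy-fullColumns≤ : ∀ {N B} c l α → c ℕ.+ l ≡ N → l ℕ.≤ c → α ℕ.≤ l → SplitBound N B →
                          σ-greedy (+ N) (+ c) (+ c) (+ α) 0ℤ ≤ B
  σ-greedy-fullColumns≤ {B = B} c l α refl l≤c α≤l bound with ℕ.m≤n⇒∃[o]m+o≡n α≤l
  ... | p , refl =
    subst (_≤ B) (trans (sym (σ-greedy-fullColumns (+ c) (+ p) (+ α))) (cong (λ n → σ-greedy (+ n) (+ c) (+ c) (+ α) 0ℤ) N≡))
      (σ₃≤ α p c (subst (ℕ._≤ c) (ℕ.+-comm α p) l≤c) (λ a b eq → bound a b (trans eq (sym N≡′))))
    where
    N≡ : c ℕ.+ (p ℕ.+ α) ≡ c ℕ.+ (α ℕ.+ p)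
    N≡ = cong (c ℕ.+_) (ℕ.+-comm p α)
    N≡′ : c ℕ.+ (α ℕ.+ p) ≡ p ℕ.+ α ℕ.+ c
    N≡′ = trans (ℕ.+-comm c (α ℕ.+ p)) (cong (ℕ._+ c) (ℕ.+-comm α p))

module ReductionToSplitGraphs where

  open import Data.Integer using (ℤ; +_; 0ℤ; 1ℤ; _+_; _*_; _-_; -_; _≤_; +≤+)
  open import Data.Integer.Properties using (+-monoˡ-≤; +-monoʳ-≤; *-monoˡ-≤-nonNeg; module ≤-Reasoning)
  open import Data.List using (List; map; length; allFin)
  open import Data.List.Properties using (length-map)
  import Data.List.Relation.Unary.All as All
  open import Data.Nat as ℕ using (zero; suc; z≤n; s≤s)
  import Data.Nat.Properties as ℕ
  open import Relation.Nullary using (Dec; yes; no)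
  open import Relation.Binary.PropositionalEquality using (_≡_; refl; sym; trans; subst)

  open import Defs using (Graph; sigmaT)
  open Variance using (σ)
  open DegreeSums using (length-allFin; module Degrees)
  open ThresholdGraphs using (σ-deg≤σ-thresholdDeg; centred; thresholdDeg)
  open FerrersDiagrams
  open ThresholdValues
  open ThreeDegreeClasses using (SplitBound)
  open GreedyPacking

  σ-threshold-mono : ∀ N C R {Q Q′} → Q ≤ Q′ → σ-threshold (+ N) C R Q ≤ σ-threshold (+ N) C R Q′
  σ-threshold-mono N C R Q≤Q′ = +-monoˡ-≤ (- (D * D)) (*-monoˡ-≤-nonNeg (+ N) (+-monoʳ-≤ L Q≤Q′))
    where
    D = C * (C - 1ℤ) + + 2 * R
    L = C * ((C - 1ℤ) * (C - 1ℤ)) + + 2 * (C - 1ℤ) * R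

  σ-threshold≤ : ∀ {N B} c m K R Q → 3 ℕ.≤ N → m ℕ.+ K ≡ N → c ℕ.≤ N → R ℕ.≤ m ℕ.* K →
                 GreedyBound K R Q → SplitBound N B →
                 (∀ α → α ℕ.≤ m → σ-greedy (+ N) (+ c) (+ K) (+ α) 0ℤ ≤ B) →
                 σ-threshold (+ N) (+ c) (+ R) (+ Q) ≤ B
  σ-threshold≤ {N} {B} c m K R Q 3≤N m+K≡N c≤N R≤mK (greedy α ρ ρ<K _ refl Q≤) bound full = begin
    σ-threshold (+ N) (+ c) (+ (α ℕ.* K ℕ.+ ρ)) (+ Q)
      ≤⟨ σ-threshold-mono N (+ c) _ (+≤+ Q≤) ⟩
    σ-threshold (+ N) (+ c) (+ (α ℕ.* K ℕ.+ ρ)) (+ greedySquares K α ρ)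
      ≡⟨ σ-threshold-greedy N c K α ρ ⟩
    σ-greedy (+ N) (+ c) (+ K) (+ α) (+ ρ)
      ≤⟨ σ-greedy≤ c m K α ρ 3≤N m+K≡N c≤N ρ<K R≤mK bound full ⟩
    B ∎
    where open ≤-Reasoning

  larger-part-positive : ∀ c l → 3 ℕ.≤ c ℕ.+ l → c ℕ.≤ l → 1 ℕ.≤ l
  larger-part-positive c       (suc l) _  _  = s≤s z≤n
  larger-part-positive zero    zero    () _
  larger-part-positive (suc c) zero    _  ()

  module _ {B} (xs : List ℤ) (3≤N : 3 ℕ.≤ length xs) (bound : SplitBound (length xs) B) where
    open Decomposition xs

    -- The Ferrers diagram fits in a K × K box for K = max(|Pos|, |NonPos|).
    σ-thresholdDegOf≤ : σ xs (thresholdDegOf xs) ≤ B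
    σ-thresholdDegOf≤ = subst (_≤ B) (sym σ-h) (byCases (c ℕ.≤? l))
      where
      c = length Pos
      l = length NonPos
      c≤N : c ℕ.≤ length xs
      c≤N = subst (c ℕ.≤_) length-Pos+NonPos (ℕ.m≤m+n c l)
      cells≤ : cells rows ℕ.≤ c ℕ.* l
      cells≤ = subst (λ k → cells rows ℕ.≤ k ℕ.* l) length-rows (cells≤length* rows rows≤)
      col≤c : firstColumn rows ℕ.≤ c
      col≤c = subst (firstColumn rows ℕ.≤_) length-rows (firstColumn≤length rows)
      byCases : Dec (c ℕ.≤ l) → σ-threshold (+ length xs) (+ c) (+ cells rows) (+ squares rows) ≤ B
      byCases (yes c≤l) =
        σ-threshold≤ c c l _ _ 3≤N length-Pos+NonPos c≤N cells≤
                     (squares≤greedy rows 1≤l (ℕ.≤-trans col≤c c≤l) rows≤) bound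
                     (λ α α≤c → σ-greedy-fullRows≤ c l α length-Pos+NonPos c≤l α≤c bound)
        where
        1≤l : 1 ℕ.≤ l
        1≤l = larger-part-positive c l (subst (3 ℕ.≤_) (sym length-Pos+NonPos) 3≤N) c≤l
      byCases (no c≰l) =
        σ-threshold≤ c l c _ _ 3≤N (trans (ℕ.+-comm l c) length-Pos+NonPos) c≤N (subst (cells rows ℕ.≤_) (ℕ.*-comm c l) cells≤)
                     (squares≤greedy rows (ℕ.≤-trans (s≤s z≤n) l<c) col≤c
                                     (All.map (λ a≤l → ℕ.≤-trans a≤l (ℕ.<⇒≤ l<c)) rows≤)) bound
                     (λ α α≤l → σ-greedy-fullColumns≤ c l α length-Pos+NonPos (ℕ.<⇒≤ l<c) α≤l bound)
        where
        l<c : l ℕ.< c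
        l<c = ℕ.≰⇒> c≰l

  sigmaT≤ : ∀ {n B} → 3 ℕ.≤ n → SplitBound n B → (G : Graph n) → + sigmaT G ≤ B
  sigmaT≤ {n} {B} 3≤n bound G = begin
    + sigmaT G                                ≡⟨ sigmaT≡σ ⟩
    σ (allFin n) deg                          ≤⟨ σ-deg≤σ-thresholdDeg G ⟩
    σ (allFin n) (thresholdDeg (centred G))   ≡⟨ σ-thresholdDeg≡ (centred G) ⟩
    σ xs (thresholdDegOf xs)                  ≤⟨ σ-thresholdDegOf≤ xs (subst (3 ℕ.≤_) (sym length-xs) 3≤n)
                                                   (λ a b eq → bound a b (trans eq length-xs)) ⟩
    B                                         ∎
    where
    open ≤-Reasoning
    open Degrees G
    xs = map (centred G) (allFin n)
    length-xs : length xs ≡ n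
    length-xs = trans (length-map (centred G) (allFin n)) (length-allFin n)

module SplitGraphs where

  open import Data.Bool using (Bool; true; false; if_then_else_)
  open import Data.Fin using (toℕ)
  open import Data.Fin.Properties using (_≟_)
  open import Data.Integer using (ℤ; +_; 0ℤ; 1ℤ; _+_; _*_; _-_)
  open import Data.Integer.Properties using (+-injective; *-identityʳ; +-identityˡ)
  open import Data.Integer.Tactic.RingSolver using (solve-∀)
  open import Data.List using (allFin)
  open import Data.Nat as ℕ using (ℕ; zero; suc; _<ᵇ_; _∸_; s≤s)
  import Data.Nat.Properties as ℕ
  open import Relation.Nullary using (yes; no; does)
  open import Relation.Binary.PropositionalEquality using (_≡_; refl; sym; trans; cong; cong₂; module ≡-Reasoning)

  open import Defs using (sigmaT; splitGraph)
  open Variance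
  open DegreeSums using (𝟙; ∑-allFin-const; σ-allFin; ∑-allFin-suc; ∑-punctured; module Degrees)
  open ThreeDegreeClasses using (sigmaSplit; σ-split; +sigmaSplit)

  ∑-initial : ∀ {N a} (g : Bool → ℤ) → a ℕ.≤ N →
              ∑[ u ∈ allFin N ] g (toℕ u <ᵇ a) ≡ + a * g true + + (N ∸ a) * g false
  ∑-initial {zero}  {zero}  g _         = refl
  ∑-initial {suc N} {zero}  g _         = trans (∑-allFin-const (suc N) (g false)) (sym (+-identityˡ _))
  ∑-initial {suc N} {suc a} g (s≤s a≤N) = trans (∑-allFin-suc {N} (λ u → g (toℕ u <ᵇ suc a)))
    (trans (cong (_+_ (g true)) (∑-initial {N} g a≤N)) (lemma (g true) (+ a) (+ (N ∸ a) * g false)))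
    where
    lemma : ∀ t a x → t + (a * t + x) ≡ (1ℤ + a) * t + x
    lemma = solve-∀

  module _ (a b : ℕ) where
    open Degrees (splitGraph a b)

    deg-split : ∀ u → deg u ≡ (if toℕ u <ᵇ a then + (a ℕ.+ b) - 1ℤ else + a)
    deg-split u = trans (deg≡∑adjacency u) (byClass (toℕ u <ᵇ a) refl)
      where
      byClass : ∀ t → (toℕ u <ᵇ a) ≡ t → ∑ (allFin (a ℕ.+ b)) (adjacency u) ≡ (if t then + (a ℕ.+ b) - 1ℤ else + a)
      byClass true u<a = trans (∑-cong (allFin (a ℕ.+ b)) clique)
        (trans (∑-punctured u (λ _ → 1ℤ)) (cong (_- 1ℤ) (trans (∑-allFin-const (a ℕ.+ b) 1ℤ) (*-identityʳ (+ (a ℕ.+ b))))))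
        where
        clique : ∀ v → adjacency u v ≡ (if does (u ≟ v) then 0ℤ else 1ℤ)
        clique v with u ≟ v
        ... | yes _ = refl
        ... | no  _ rewrite u<a = refl
      byClass false u≮a = trans (∑-cong (allFin (a ℕ.+ b)) independent)
        (trans (∑-initial 𝟙 (ℕ.m≤m+n a b)) (lemma (+ a) (+ (a ℕ.+ b ∸ a))))
        where
        independent : ∀ v → adjacency u v ≡ 𝟙 (toℕ v <ᵇ a)
        independent v with u ≟ v
        ... | yes refl rewrite u≮a = refl
        ... | no  _    rewrite u≮a = refl
        lemma : ∀ a x → a * 1ℤ + x * 0ℤ ≡ a
        lemma = solve-∀

    sigmaT-splitGraph : sigmaT (splitGraph a b) ≡ sigmaSplit a b
    sigmaT-splitGraph = +-injective (begin
      + sigmaT (splitGraph a b)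
        ≡⟨ trans sigmaT≡σ (σ-allFin deg) ⟩
      + (a ℕ.+ b) * ∑[ u ∈ allFin (a ℕ.+ b) ] (deg u * deg u) - ∑ (allFin (a ℕ.+ b)) deg * ∑ (allFin (a ℕ.+ b)) deg
        ≡⟨ cong₂ (λ s t → + (a ℕ.+ b) * s - t * t) (∑-degrees (λ d → d * d)) (∑-degrees (λ d → d)) ⟩
      + (a ℕ.+ b) * (+ a * (D * D) + + b * (+ a * + a)) - (+ a * D + + b * + a) * (+ a * D + + b * + a)
        ≡⟨ identity (+ a) (+ b) ⟩
      σ-split (+ a) (+ b)
        ≡⟨ +sigmaSplit a b ⟨
      + sigmaSplit a b ∎)
      where
      open ≡-Reasoning
      D = + (a ℕ.+ b) - 1ℤ
      ∑-degrees : ∀ (g : ℤ → ℤ) → ∑[ u ∈ allFin (a ℕ.+ b) ] g (deg u) ≡ + a * g D + + b * g (+ a)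
      ∑-degrees g = trans (∑-cong (allFin (a ℕ.+ b)) (λ u → trans (cong g (deg-split u)) (push (toℕ u <ᵇ a))))
        (trans (∑-initial (λ t → if t then g D else g (+ a)) (ℕ.m≤m+n a b))
               (cong (λ n → + a * g D + + n * g (+ a)) (ℕ.m+n∸m≡n a b)))
        where
        push : ∀ t → g (if t then D else + a) ≡ (if t then g D else g (+ a))
        push true  = refl
        push false = refl
      identity : ∀ A B → let D = A + B - 1ℤ in
                 (A + B) * (A * (D * D) + B * (A * A)) - (A * D + B * A) * (A * D + B * A) ≡ A * B * ((B - 1ℤ) * (B - 1ℤ))
      identity = solve-∀

module Unimodality where

  open import Data.Nat
  open import Data.Nat.Properties
  open import Data.Nat.Tactic.RingSolver using (solve-∀)
  open import Data.Product using (_,_)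
  open import Data.Sum using (inj₁; inj₂)
  open import Relation.Binary.PropositionalEquality using (_≡_; refl; sym; trans; cong; cong₂; subst; subst₂; module ≡-Reasoning)

  open ThreeDegreeClasses using (sigmaSplit)

  ≤-of-+ : ∀ {m n} d → m + d ≡ n → m ≤ n
  ≤-of-+ {m} d refl = m≤m+n m d

  sigmaSplit-zero : ∀ a → sigmaSplit a 0 ≡ 0
  sigmaSplit-zero a = cong (_* 0) (*-zeroʳ a)

  sigmaSplit-step↑ : ∀ a b → 2 + 3 * a ≤ b → sigmaSplit a (suc b) ≤ sigmaSplit (suc a) b
  sigmaSplit-step↑ a (suc b) (s≤s 1+3a≤b) with m≤n⇒∃[o]m+o≡n 1+3a≤b
  ... | t , eq = subst (λ b → sigmaSplit a (suc (suc b)) ≤ sigmaSplit (suc a) (suc b)) eq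
                       (≤-of-+ ((2 + 3 * a + t) * (t * t + 3 * a * t + 2 * t + a + 1)) (identity a t))
    where
    identity : ∀ a t → let b = 1 + 3 * a + t in
               a * (2 + b) * ((1 + b) * ((1 + b) * 1)) + (1 + b) * (t * t + 3 * a * t + 2 * t + a + 1)
               ≡ (1 + a) * (1 + b) * (b * (b * 1))
    identity = solve-∀

  sigmaSplit-step↓ : ∀ a b → b ≤ 1 + 3 * a → sigmaSplit (suc a) b ≤ sigmaSplit a (suc b)
  sigmaSplit-step↓ a zero    _ = subst (_≤ sigmaSplit a 1) (sym (sigmaSplit-zero (suc a))) z≤n
  sigmaSplit-step↓ a (suc t) (s≤s t≤3a) with m≤n⇒∃[o]m+o≡n t≤3a
  ... | s , t+s≡3a = *-cancelˡ-≤ 3 (≤-of-+ c (begin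
    3 * ((1 + a) * (1 + t) * (t * (t * 1))) + c            ≡⟨ scale a t c ⟩
    (3 * a + 3) * (1 + t) * (t * (t * 1)) + c              ≡⟨ cong (λ x → (x + 3) * (1 + t) * (t * (t * 1)) + c) (sym t+s≡3a) ⟩
    (t + s + 3) * (1 + t) * (t * (t * 1)) + c              ≡⟨ identity t s ⟩
    (t + s) * (2 + t) * ((1 + t) * ((1 + t) * 1))          ≡⟨ cong (λ x → x * (2 + t) * ((1 + t) * ((1 + t) * 1))) t+s≡3a ⟩
    3 * a * (2 + t) * ((1 + t) * ((1 + t) * 1))            ≡⟨ unscale a t ⟩
    3 * (a * (2 + t) * ((1 + t) * ((1 + t) * 1)))          ∎))
    where
    open ≡-Reasoning
    c = (1 + t) * (2 * s + 3 * t * s + 2 * t)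
    scale : ∀ a t c → 3 * ((1 + a) * (1 + t) * (t * (t * 1))) + c ≡ (3 * a + 3) * (1 + t) * (t * (t * 1)) + c
    scale = solve-∀
    identity : ∀ t s → (t + s + 3) * (1 + t) * (t * (t * 1)) + (1 + t) * (2 * s + 3 * t * s + 2 * t)
                       ≡ (t + s) * (2 + t) * ((1 + t) * ((1 + t) * 1))
    identity = solve-∀
    unscale : ∀ a t → 3 * a * (2 + t) * ((1 + t) * ((1 + t) * 1)) ≡ 3 * (a * (2 + t) * ((1 + t) * ((1 + t) * 1)))
    unscale = solve-∀

  sigmaSplit-up : ∀ d a b → 3 * (a + d) ≤ suc b → sigmaSplit a (b + d) ≤ sigmaSplit (a + d) b
  sigmaSplit-up zero    a b _ = ≤-reflexive (cong₂ sigmaSplit (sym (+-identityʳ a)) (+-identityʳ b))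
  sigmaSplit-up (suc d) a b h = begin
    sigmaSplit a (b + suc d)    ≡⟨ cong (sigmaSplit a) (+-suc b d) ⟩
    sigmaSplit a (suc (b + d))  ≤⟨ sigmaSplit-step↑ a (b + d) 2+3a≤b+d ⟩
    sigmaSplit (suc a) (b + d)  ≤⟨ sigmaSplit-up d (suc a) b (subst (λ x → 3 * x ≤ suc b) (+-suc a d) h) ⟩
    sigmaSplit (suc a + d) b    ≡⟨ cong (λ x → sigmaSplit x b) (+-suc a d) ⟨
    sigmaSplit (a + suc d) b    ∎
    where
    open ≤-Reasoning
    expand : ∀ a d → 3 * (a + suc d) ≡ suc (2 + 3 * a + 3 * d)
    expand = solve-∀
    2+3a≤b+d : 2 + 3 * a ≤ b + d
    2+3a≤b+d = m≤n⇒m≤n+o d (m+n≤o⇒m≤o (2 + 3 * a) (s≤s⁻¹ (subst (_≤ suc b) (expand a d) h)))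

  sigmaSplit-down : ∀ d a b → b + d ≤ 2 + 3 * a → sigmaSplit (a + d) b ≤ sigmaSplit a (b + d)
  sigmaSplit-down zero    a b _ = ≤-reflexive (cong₂ sigmaSplit (+-identityʳ a) (sym (+-identityʳ b)))
  sigmaSplit-down (suc d) a b h = begin
    sigmaSplit (a + suc d) b    ≡⟨ cong (λ x → sigmaSplit x b) (+-suc a d) ⟩
    sigmaSplit (suc (a + d)) b  ≤⟨ sigmaSplit-step↓ (a + d) b b≤1+3[a+d] ⟩
    sigmaSplit (a + d) (suc b)  ≤⟨ sigmaSplit-down d a (suc b) (subst (_≤ 2 + 3 * a) (+-suc b d) h) ⟩
    sigmaSplit a (suc b + d)    ≡⟨ cong (sigmaSplit a) (+-suc b d) ⟨
    sigmaSplit a (b + suc d)    ∎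
    where
    open ≤-Reasoning
    b≤1+3[a+d] : b ≤ 1 + 3 * (a + d)
    b≤1+3[a+d] = ≤-trans (m+n≤o⇒m≤o b (s≤s⁻¹ (subst (_≤ 2 + 3 * a) (+-suc b d) h)))
                         (s≤s (*-monoʳ-≤ 3 (m≤m+n a d)))

  -- sigmaSplit a b, along a + b = n, increases while 4a ≤ n − 3 and decreases once 4a ≥ n − 2.
  sigmaSplit-max : ∀ {a* b*} → 3 * a* ≤ suc b* → b* ≤ 2 + 3 * a* →
                   ∀ a b → a + b ≡ a* + b* → sigmaSplit a b ≤ sigmaSplit a* b*
  sigmaSplit-max {a*} {b*} 3a*≤1+b* b*≤2+3a* a b a+b≡n with ≤-total a a*
  ... | inj₁ a≤a* with m≤n⇒∃[o]m+o≡n a≤a*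
  ...   | d , a+d≡a* = subst₂ (λ x y → sigmaSplit a x ≤ sigmaSplit y b*) (sym b≡b*+d) a+d≡a*
                         (sigmaSplit-up d a b* (subst (λ x → 3 * x ≤ suc b*) (sym a+d≡a*) 3a*≤1+b*))
    where
    b≡b*+d : b ≡ b* + d
    b≡b*+d = +-cancelˡ-≡ a b (b* + d) (trans a+b≡n (trans (cong (_+ b*) (sym a+d≡a*)) (lemma a d b*)))
      where
      lemma : ∀ a d b → a + d + b ≡ a + (b + d)
      lemma = solve-∀
  sigmaSplit-max {a*} {b*} 3a*≤1+b* b*≤2+3a* a b a+b≡n | inj₂ a*≤a with m≤n⇒∃[o]m+o≡n a*≤a
  ...   | d , a*+d≡a = subst₂ (λ x y → sigmaSplit x b ≤ sigmaSplit a* y) a*+d≡a b+d≡b*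
                         (sigmaSplit-down d a* b (subst (_≤ 2 + 3 * a*) (sym b+d≡b*) b*≤2+3a*))
    where
    b+d≡b* : b + d ≡ b*
    b+d≡b* = +-cancelˡ-≡ a* (b + d) b* (trans (lemma a* d b) (trans (cong (_+ b) a*+d≡a) a+b≡n))
      where
      lemma : ∀ a d b → a + (b + d) ≡ a + d + b
      lemma = solve-∀

open import Data.Integer as ℤ using (+_; +≤+)
open import Data.Integer.Properties using (drop‿+≤+)
open import Data.Nat
open import Data.Nat.Properties
open import Data.Nat.DivMod using (m≡m%n+[m/n]*n; /-congˡ; +-distrib-/-∣ʳ; m<n⇒m/n≡0; m*n/n≡m)
open import Data.Nat.Divisibility using (divides)
open import Data.Nat.Tactic.RingSolver using (solve-∀)
open import Data.Product using (_×_; _,_; Σ)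
open import Data.Sum using (inj₁; inj₂)
open import Relation.Binary.PropositionalEquality using (_≡_; refl; sym; trans; cong; cong₂; subst; subst₂; module ≡-Reasoning)

open import Defs using (Graph; Connected; sigmaT; splitGraph; ceil4; floor4; ceil34; floor34; Case03; Case12)
open ThreeDegreeClasses using (sigmaSplit; +sigmaSplit; SplitBound)
open Unimodality using (sigmaSplit-max; ≤-of-+)
open SplitGraphs using (sigmaT-splitGraph)
open ReductionToSplitGraphs using (sigmaT≤)

-- n − 2 ≤ 4a ≤ n + 1, written for the two parts a + b = n
QuarterSplit : ℕ → ℕ → ℕ → Set
QuarterSplit n a b = a + b ≡ n × 3 * a ≤ suc b × b ≤ 2 + 3 * a

quotient4 : ∀ {m} j k → m ≡ j + k * 4 → j < 4 → m / 4 ≡ k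
quotient4 j k m≡ j<4 = trans (/-congˡ m≡) (trans (+-distrib-/-∣ʳ j (divides k refl)) (cong₂ _+_ (m<n⇒m/n≡0 j<4) (m*n/n≡m k 4)))

quarterSplit₀ : ∀ k → QuarterSplit (0 + k * 4) (ceil4 (0 + k * 4)) (floor34 (0 + k * 4))
quarterSplit₀ k = subst₂ (QuarterSplit (k * 4)) (sym (quotient4 3 k (+-comm (k * 4) 3) (s<s (s<s (s<s z<s)))))
                                                  (sym (quotient4 0 (3 * k) (floor≡ k) z<s))
                                                  (sum≡ k , n≤1+n (3 * k) , m≤n+m (3 * k) 2)
  where
  floor≡ : ∀ k → 3 * (k * 4) ≡ 0 + 3 * k * 4
  floor≡ = solve-∀
  sum≡ : ∀ k → k + 3 * k ≡ k * 4
  sum≡ = solve-∀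

quarterSplit₃ : ∀ k → QuarterSplit (3 + k * 4) (ceil4 (3 + k * 4)) (floor34 (3 + k * 4))
quarterSplit₃ k = subst₂ (QuarterSplit (3 + k * 4)) (sym (quotient4 2 (1 + k) (ceil≡ k) (s<s (s<s z<s))))
                                                      (sym (quotient4 1 (2 + 3 * k) (floor≡ k) (s<s z<s)))
                                                      (sum≡ k , ≤-reflexive (tight k) , ≤-of-+ 3 (slack k))
  where
  ceil≡ : ∀ k → 3 + k * 4 + 3 ≡ 2 + (1 + k) * 4
  ceil≡ = solve-∀
  floor≡ : ∀ k → 3 * (3 + k * 4) ≡ 1 + (2 + 3 * k) * 4
  floor≡ = solve-∀
  sum≡ : ∀ k → 1 + k + (2 + 3 * k) ≡ 3 + k * 4
  sum≡ = solve-∀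
  tight : ∀ k → 3 * (1 + k) ≡ suc (2 + 3 * k)
  tight = solve-∀
  slack : ∀ k → 2 + 3 * k + 3 ≡ 2 + 3 * (1 + k)
  slack = solve-∀

quarterSplit₁ : ∀ k → QuarterSplit (1 + k * 4) (floor4 (1 + k * 4)) (ceil34 (1 + k * 4))
quarterSplit₁ k = subst₂ (QuarterSplit (1 + k * 4)) (sym (quotient4 1 k refl (s<s z<s)))
                                                      (sym (quotient4 2 (1 + 3 * k) (ceil≡ k) (s<s (s<s z<s))))
                                                      (sum≡ k , ≤-of-+ 2 (slack k) , n≤1+n (1 + 3 * k))
  where
  ceil≡ : ∀ k → 3 * (1 + k * 4) + 3 ≡ 2 + (1 + 3 * k) * 4
  ceil≡ = solve-∀
  sum≡ : ∀ k → k + (1 + 3 * k) ≡ 1 + k * 4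
  sum≡ = solve-∀
  slack : ∀ k → 3 * k + 2 ≡ suc (1 + 3 * k)
  slack = solve-∀

quarterSplit₂ : ∀ k → QuarterSplit (2 + k * 4) (floor4 (2 + k * 4)) (ceil34 (2 + k * 4))
quarterSplit₂ k = subst₂ (QuarterSplit (2 + k * 4)) (sym (quotient4 2 k refl (s<s (s<s z<s))))
                                                      (sym (quotient4 1 (2 + 3 * k) (ceil≡ k) (s<s z<s)))
                                                      (sum≡ k , ≤-of-+ 3 (slack k) , ≤-refl)
  where
  ceil≡ : ∀ k → 3 * (2 + k * 4) + 3 ≡ 1 + (2 + 3 * k) * 4
  ceil≡ = solve-∀
  sum≡ : ∀ k → k + (2 + 3 * k) ≡ 2 + k * 4
  sum≡ = solve-∀
  slack : ∀ k → 3 * k + 3 ≡ suc (2 + 3 * k)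
  slack = solve-∀

residue : ∀ n {e} → n % 4 ≡ e → n ≡ e + n / 4 * 4
residue n n%4≡e = trans (m≡m%n+[m/n]*n n 4) (cong (_+ n / 4 * 4) n%4≡e)

quarterSplit-03 : ∀ n → Case03 n → QuarterSplit n (ceil4 n) (floor34 n)
quarterSplit-03 n (inj₁ n%4≡0) = subst (λ m → QuarterSplit m (ceil4 m) (floor34 m)) (sym (residue n n%4≡0)) (quarterSplit₀ (n / 4))
quarterSplit-03 n (inj₂ n%4≡3) = subst (λ m → QuarterSplit m (ceil4 m) (floor34 m)) (sym (residue n n%4≡3)) (quarterSplit₃ (n / 4))

quarterSplit-12 : ∀ n → Case12 n → QuarterSplit n (floor4 n) (ceil34 n)
quarterSplit-12 n (inj₁ n%4≡1) = subst (λ m → QuarterSplit m (floor4 m) (ceil34 m)) (sym (residue n n%4≡1)) (quarterSplit₁ (n / 4))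
quarterSplit-12 n (inj₂ n%4≡2) = subst (λ m → QuarterSplit m (floor4 m) (ceil34 m)) (sym (residue n n%4≡2)) (quarterSplit₂ (n / 4))

extremal : ∀ {n a b} → 3 ≤ n → QuarterSplit n a b →
           ((G : Graph n) → Connected G → sigmaT G ≤ a * b * (n ∸ 1 ∸ a) ^ 2)
           × Σ (a + b ≡ n) (λ _ → sigmaT (splitGraph a b) ≡ a * b * (n ∸ 1 ∸ a) ^ 2)
extremal {n} {a} {b} 3≤n (a+b≡n , 3a≤1+b , b≤2+3a) =
  (λ G _ → subst (sigmaT G ≤_) value (drop‿+≤+ (sigmaT≤ 3≤n splitBound G)))
  , a+b≡n , trans (sigmaT-splitGraph a b) value
  where
  value : sigmaSplit a b ≡ a * b * (n ∸ 1 ∸ a) ^ 2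
  value = cong (λ x → a * b * x ^ 2) (begin
    b ∸ 1                ≡⟨ [m+n]∸[m+o]≡n∸o a b 1 ⟨
    (a + b) ∸ (a + 1)    ≡⟨ cong ((a + b) ∸_) (+-comm a 1) ⟩
    (a + b) ∸ (1 + a)    ≡⟨ ∸-+-assoc (a + b) 1 a ⟨
    (a + b) ∸ 1 ∸ a      ≡⟨ cong (λ m → m ∸ 1 ∸ a) a+b≡n ⟩
    n ∸ 1 ∸ a            ∎)
    where open ≡-Reasoning
  splitBound : SplitBound n (+ sigmaSplit a b)
  splitBound a′ b′ a′+b′≡n = subst (ℤ._≤ + sigmaSplit a b) (+sigmaSplit a′ b′)
                               (+≤+ (sigmaSplit-max 3a≤1+b b≤2+3a a′ b′ (trans a′+b′≡n (sym a+b≡n))))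

theorem9 : (n : ℕ) → 3 ≤ n →
  (Case03 n →
    ((G : Graph n) → Connected G →
       sigmaT G ≤ ceil4 n * floor34 n * (n ∸ 1 ∸ ceil4 n) ^ 2)
    × Σ (ceil4 n + floor34 n ≡ n) (λ _ →
        sigmaT (splitGraph (ceil4 n) (floor34 n))
          ≡ ceil4 n * floor34 n * (n ∸ 1 ∸ ceil4 n) ^ 2))
  × (Case12 n →
    ((G : Graph n) → Connected G →
       sigmaT G ≤ floor4 n * ceil34 n * (n ∸ 1 ∸ floor4 n) ^ 2)
    × Σ (floor4 n + ceil34 n ≡ n) (λ _ →
        sigmaT (splitGraph (floor4 n) (ceil34 n))
          ≡ floor4 n * ceil34 n * (n ∸ 1 ∸ floor4 n) ^ 2))
theorem9 n 3≤n = (λ case → extremal 3≤n (quarterSplit-03 n case)) , (λ case → extremal 3≤n (quarterSplit-12 n case))
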